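{- For every integer $q \geq 2$, \[ \mathbb{I}(Z_2,q) = \sum_{j=0}^{\infty} \frac{(-1)^j q^{\left(1-2^{j+1}\right)}}{\prod_{k=0}^{j} \left(1 - q^{\left(1-2^{k+1}\right)}\right)}. \]
   Context: $Z_2 = aba$. A word $U$ is an instance of $aba$ if $U = XYX$ for some nonempty words $X,Y$. For $q\ge 1$, $[q]=\{1,\dots,q\}$; $\mathbb{I}_n(Z_2,q)$ is the probability that a uniformly random word in $[q]^n$ is an instance of $Z_2$, and $\mathbb{I}(Z_2,q)=\lim_{n\to\infty}\mathbb{I}_n(Z_2,q)$ (this limit exists). -}

module Defs where

open import Data.Nat as ℕ using (ℕ; zero; suc)
open import Data.Integer as ℤ using (ℤ; +_; -[1+_])
open import Data.Rational using (ℚ; 0ℚ; 1ℚ; _+_; _*_; _-_; -_; ∣_∣; _<_; _≤_; _/_; 1/_; ≢-nonZero)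
open import Data.Rational.Properties using (_≟_)
open import Data.Fin using (Fin)
open import Data.List using (List; []; _++_)
open import Data.Vec using (Vec; toList)
open import Data.Product using (Σ; ∃; ∃-syntax; _×_)
open import Relation.Binary.PropositionalEquality using (_≡_; _≢_)
open import Relation.Nullary using (yes; no)
open import Function.Definitions using (Injective)

IsInstanceZ₂ : ∀ {a} {A : Set a} → List A → Set a
IsInstanceZ₂ {A = A} U =
  ∃[ X ] ∃[ Y ] (X ≢ [] × Y ≢ [] × U ≡ X ++ Y ++ X)

Word : ℕ → ℕ → Set
Word q n = Vec (Fin q) n

-- c is the number of instances of Z₂ in [q]^n: there is an injective
-- enumeration Fin c → [q]^n whose image is exactly the set of instances.
NumInstances : (q n c : ℕ) → Set
NumInstances q n c =
  Σ (Fin c → Word q n) λ f →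
    Injective _≡_ _≡_ f
    × (∀ i → IsInstanceZ₂ (toList (f i)))
    × (∀ w → IsInstanceZ₂ (toList w) → ∃[ i ] f i ≡ w)

-- Total reciprocal on ℚ (only ever applied to nonzero arguments below).
recip : ℚ → ℚ
recip p with p ≟ 0ℚ
... | yes _ = 0ℚ
... | no p≢0 = 1/_ p {{≢-nonZero p≢0}}

_^ℕ_ : ℚ → ℕ → ℚ
p ^ℕ zero = 1ℚ
p ^ℕ suc n = p * (p ^ℕ n)

_^ℤ_ : ℚ → ℤ → ℚ
p ^ℤ (+ n) = p ^ℕ n
p ^ℤ -[1+ n ] = recip (p ^ℕ suc n)

fromℕ : ℕ → ℚ
fromℕ n = (+ n) / 1

-- 𝕀ₙ(Z₂,q) given the instance count c: c / qⁿ
prob : (q n c : ℕ) → ℚ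
prob q n c = fromℕ c * recip (fromℕ q ^ℕ n)

e : ℕ → ℕ → ℚ
e q k = fromℕ q ^ℤ ((+ 1) ℤ.- (+ (2 ℕ.^ suc k)))

denom : ℕ → ℕ → ℚ
denom q zero = 1ℚ - e q 0
denom q (suc j) = denom q j * (1ℚ - e q (suc j))

term : ℕ → ℕ → ℚ
term q j = ((- 1ℚ) ^ℕ j) * e q j * recip (denom q j)

-- partial sum  Σ_{j=0}^{m-1} term q j
partial : ℕ → ℕ → ℚ
partial q zero = 0ℚ
partial q (suc m) = partial q m + term q m

-- A border of a word is a nonempty proper prefix that is also a suffix.  U is
-- an instance of aba iff it has a border of length ≤ (|U| - 1)/2, and a word
-- is classified by its shortest border, which is always unbordered.  With
-- u_b the number of unbordered words of length b and C n K = Σ_{b≤K} u_b q^(n-2b):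
--   #instances of length n = C n ⌊(n-1)/2⌋      and      qⁿ = u_n + C n ⌊n/2⌋.
-- For x = 1/q, a_b = u_b xᵇ and G_M(y) = Σ_{1≤b≤M} a_b yᵇ these say
--   𝕀ₙ = G_{⌊(n-1)/2⌋}(x)      and      a_n = 1 - G_{⌊n/2⌋}(x),
-- and the second identity gives the truncated functional equation
--   (1 - y) G_M(y) + G_{⌊M/2⌋}(x y²) = y - a_M y^(M+1).
-- Iterating it along e₀ = x, e_{k+1} = x e_k² produces the partial sums of the
-- series, with errors of order 2^(-j) and j · 2^(-M/2^j); taking first j and
-- then n large yields the ε-N statement.

module Submission where

open import Defs
open import Data.Nat using (ℕ; _≥_)
open import Data.Rational using (ℚ; 0ℚ; _<_; _-_; ∣_∣)
open import Data.Product using (∃-syntax; _×_; _,_)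
import Data.Nat as ℕ
import Data.Rational.Properties as ℚ

module Combinatorics where

  open import Data.Bool using (Bool; true; false; _∧_; _∨_; not; T)
  open import Data.Bool.Properties using (∧-zeroʳ; T-∨; T-irrelevant)
  open import Data.Empty using (⊥-elim)
  open import Data.Fin using (Fin; zero; suc)
  import Data.Fin.Properties as Fin
  open import Data.Fin.Permutation using (↔⇒≡)
  open import Data.List using (List; []; _∷_; _++_; length; take; drop)
  open import Data.List.Properties
    using (length-++; length-take; length-drop; take-take; take-drop; drop-drop; take++drop≡id; ++-assoc; ≡-dec)
  open import Data.Nat
  open import Data.Nat.Properties
  open import Algebra.Properties.Semiring.Sum +-*-semiring using (sum; ∑-distrib-+; *-distribˡ-sum; sum-cong-≗)
  open import Data.Product using (Σ; proj₁; proj₂)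
  open import Data.Product.Function.Dependent.Propositional using (Σ-↔)
  open import Data.Sum using (_⊎_; inj₁; inj₂)
  open import Data.Sum.Function.Propositional using (_⊎-↔_)
  open import Data.Unit using (tt)
  open import Data.Vec using (toList) renaming ([] to []ᵥ; _∷_ to _∷ᵥ_)
  open import Function using (_∘_)
  open import Function.Bundles using (_↔_; mk↔ₛ′; Equivalence)
  open import Function.Properties.Inverse using (↔-refl; ↔-sym; ↔-trans)
  open import Relation.Binary.Definitions using (DecidableEquality)
  open import Relation.Binary.PropositionalEquality
  open import Relation.Nullary using (Dec; does; yes; no)

  ⌊n/2⌋+⌊n/2⌋≤n : ∀ n → ⌊ n /2⌋ + ⌊ n /2⌋ ≤ n
  ⌊n/2⌋+⌊n/2⌋≤n zero = z≤n
  ⌊n/2⌋+⌊n/2⌋≤n (suc zero) = z≤n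
  ⌊n/2⌋+⌊n/2⌋≤n (suc (suc n)) =
    s≤s (≤-trans (≤-reflexive (+-suc ⌊ n /2⌋ ⌊ n /2⌋)) (s≤s (⌊n/2⌋+⌊n/2⌋≤n n)))

  n≤1+⌊n/2⌋+⌊n/2⌋ : ∀ n → n ≤ suc (⌊ n /2⌋ + ⌊ n /2⌋)
  n≤1+⌊n/2⌋+⌊n/2⌋ zero = z≤n
  n≤1+⌊n/2⌋+⌊n/2⌋ (suc zero) = s≤s z≤n
  n≤1+⌊n/2⌋+⌊n/2⌋ (suc (suc n)) =
    s≤s (s≤s (≤-trans (n≤1+⌊n/2⌋+⌊n/2⌋ n) (≤-reflexive (sym (+-suc ⌊ n /2⌋ ⌊ n /2⌋)))))

  ⌊n/2⌋≤n∸1 : ∀ n → ⌊ n /2⌋ ≤ n ∸ 1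
  ⌊n/2⌋≤n∸1 zero = z≤n
  ⌊n/2⌋≤n∸1 (suc n) = s≤s⁻¹ (⌊n/2⌋<n n)

  2j<n : ∀ {j} n → 1 ≤ j → j ≤ ⌊ (n ∸ 1) /2⌋ → suc (j + j) ≤ n
  2j<n zero 1≤j j≤0 = ⊥-elim (<⇒≱ 1≤j j≤0)
  2j<n (suc n) 1≤j j≤half = s≤s (≤-trans (+-mono-≤ j≤half j≤half) (⌊n/2⌋+⌊n/2⌋≤n n))

  module _ {A : Set} where

    nonempty : (v : List A) → 1 ≤ length v → v ≢ []
    nonempty (_ ∷ _) _ ()

    take-++ˡ : (xs ys : List A) → take (length xs) (xs ++ ys) ≡ xs
    take-++ˡ [] ys = refl
    take-++ˡ (x ∷ xs) ys = cong (x ∷_) (take-++ˡ xs ys)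

    drop-++ˡ : (xs ys : List A) → drop (length xs) (xs ++ ys) ≡ ys
    drop-++ˡ [] ys = refl
    drop-++ˡ (x ∷ xs) ys = drop-++ˡ xs ys

    drop-suffix₃ : (xs ys zs : List A) →
                   drop (length (xs ++ ys ++ zs) ∸ length zs) (xs ++ ys ++ zs) ≡ zs
    drop-suffix₃ xs ys zs = subst (λ v → drop (length v ∸ length zs) v ≡ zs) (++-assoc xs ys zs)
      (trans (cong (λ n → drop (n ∸ length zs) ((xs ++ ys) ++ zs)) (length-++ (xs ++ ys)))
        (trans (cong (λ n → drop n ((xs ++ ys) ++ zs)) (m+n∸n≡m (length (xs ++ ys)) (length zs)))
          (drop-++ˡ (xs ++ ys) zs)))

    length-take-≤ : ∀ {n} (xs : List A) → n ≤ length xs → length (take n xs) ≡ n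
    length-take-≤ {n} xs n≤ = trans (length-take n xs) (m≤n⇒m⊓n≡m n≤)

    take-take-≤ : ∀ {k b} (xs : List A) → k ≤ b → take k (take b xs) ≡ take k xs
    take-take-≤ {k} {b} xs k≤b = trans (take-take k b xs) (cong (λ n → take n xs) (m≤n⇒m⊓n≡m k≤b))

    drop-take-≤ : ∀ {d b} (xs : List A) → d ≤ b → drop d (take b xs) ≡ take (b ∸ d) (drop d xs)
    drop-take-≤ {d} {b} xs d≤b =
      sym (trans (take-drop (b ∸ d) d xs) (cong (λ n → drop d (take n xs)) (m+[n∸m]≡n d≤b)))

  module Borders {A : Set} (_≟_ : DecidableEquality A) where

    _≟ₗ_ : DecidableEquality (List A)
    _≟ₗ_ = ≡-dec _≟_

    Border : ℕ → List A → Set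
    Border k w = take k w ≡ drop (length w ∸ k) w

    border-dec : ∀ k w → Dec (Border k w)
    border-dec k w = take k w ≟ₗ drop (length w ∸ k) w

    border? : ℕ → List A → Bool
    border? k w = does (border-dec k w)

    border-sound : ∀ k w → T (border? k w) → Border k w
    border-sound k w t with border-dec k w
    ... | yes b = b

    border-complete : ∀ k w → Border k w → T (border? k w)
    border-complete k w b with border-dec k w
    ... | yes _ = tt
    ... | no ¬b = ¬b b

    hasBorder≤ : ℕ → List A → Bool
    hasBorder≤ zero w = false
    hasBorder≤ (suc k) w = hasBorder≤ k w ∨ border? (suc k) w

    unbordered : List A → Bool
    unbordered x = not (hasBorder≤ (length x ∸ 1) x)

    -- the shortest nonempty border of w has length k + 1
    shortestBorder : ℕ → List A → Bool
    shortestBorder k w = not (hasBorder≤ k w) ∧ border? (suc k) w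

    hasBorder≤-intro : ∀ {j} k w → 1 ≤ j → j ≤ k → Border j w → T (hasBorder≤ k w)
    hasBorder≤-intro zero w 1≤j j≤0 b = ⊥-elim (<⇒≱ 1≤j j≤0)
    hasBorder≤-intro {j} (suc k) w 1≤j j≤k b with m≤n⇒m<n∨m≡n j≤k
    ... | inj₁ j<k = Equivalence.from T-∨ (inj₁ (hasBorder≤-intro k w 1≤j (s≤s⁻¹ j<k) b))
    ... | inj₂ refl = Equivalence.from T-∨ (inj₂ (border-complete (suc k) w b))

    hasBorder≤-elim : ∀ k w → T (hasBorder≤ k w) → ∃[ j ] (1 ≤ j × j ≤ k × Border j w)
    hasBorder≤-elim zero w ()
    hasBorder≤-elim (suc k) w t with hasBorder≤ k w in eq
    ... | true = let (j , 1≤j , j≤k , b) = hasBorder≤-elim k w (subst T (sym eq) tt)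
                 in j , 1≤j , m≤n⇒m≤1+n j≤k , b
    ... | false = suc k , s≤s z≤n , ≤-refl , border-sound (suc k) w t

    border?-prefix : ∀ {b k} w → b ≤ length w → Border b w → k ≤ b →
                     border? k (take b w) ≡ border? k w
    border?-prefix {b} {k} w b≤|w| bw k≤b =
      cong₂ (λ s t → does (s ≟ₗ t)) (take-take-≤ w k≤b) suffix
      where
      open ≡-Reasoning
      n = length w
      offset : n ∸ b + (b ∸ k) ≡ n ∸ k
      offset = trans (sym (+-∸-assoc (n ∸ b) k≤b)) (cong (_∸ k) (m∸n+n≡m b≤|w|))
      suffix : drop (length (take b w) ∸ k) (take b w) ≡ drop (n ∸ k) w
      suffix = begin
        drop (length (take b w) ∸ k) (take b w)
          ≡⟨ cong (λ m → drop (m ∸ k) (take b w)) (length-take-≤ w b≤|w|) ⟩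
        drop (b ∸ k) (take b w)
          ≡⟨ cong (drop (b ∸ k)) bw ⟩
        drop (b ∸ k) (drop (n ∸ b) w)
          ≡⟨ drop-drop (n ∸ b) (b ∸ k) w ⟩
        drop (n ∸ b + (b ∸ k)) w
          ≡⟨ cong (λ m → drop m w) offset ⟩
        drop (n ∸ k) w ∎

    hasBorder≤-prefix : ∀ {b} k w → b ≤ length w → Border b w → k ≤ b →
                        hasBorder≤ k (take b w) ≡ hasBorder≤ k w
    hasBorder≤-prefix zero w b≤|w| bw k≤b = refl
    hasBorder≤-prefix (suc k) w b≤|w| bw k<b =
      cong₂ _∨_ (hasBorder≤-prefix k w b≤|w| bw (≤-trans (n≤1+n k) k<b))
                (border?-prefix w b≤|w| bw k<b)

    shortestBorder-unbordered : ∀ k w → suc k ≤ length w →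
      shortestBorder k w ≡ unbordered (take (suc k) w) ∧ border? (suc k) w
    shortestBorder-unbordered k w k<|w| with border? (suc k) w in eq
    ... | false = trans (∧-zeroʳ _) (sym (∧-zeroʳ _))
    ... | true = cong (λ b → not b ∧ true) (begin
        hasBorder≤ k w
          ≡⟨ sym (hasBorder≤-prefix k w k<|w| (border-sound (suc k) w (subst T (sym eq) tt)) (n≤1+n k)) ⟩
        hasBorder≤ k (take (suc k) w)
          ≡⟨ cong (λ m → hasBorder≤ (m ∸ 1) (take (suc k) w)) (sym (length-take-≤ w k<|w|)) ⟩
        hasBorder≤ (length (take (suc k) w) ∸ 1) (take (suc k) w) ∎)
      where open ≡-Reasoning

    shortestBorder-++ : ∀ k (x m y : List A) → length x ≡ suc k → length y ≡ suc k →
      shortestBorder k (x ++ m ++ y) ≡ unbordered x ∧ does (x ≟ₗ y)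
    shortestBorder-++ k x m y |x| |y| = begin
        shortestBorder k w
          ≡⟨ shortestBorder-unbordered k w k<|w| ⟩
        unbordered (take (suc k) w) ∧ does (take (suc k) w ≟ₗ drop (length w ∸ suc k) w)
          ≡⟨ cong₂ (λ s t → unbordered s ∧ does (s ≟ₗ t)) prefix suffix ⟩
        unbordered x ∧ does (x ≟ₗ y) ∎
      where
      open ≡-Reasoning
      w = x ++ m ++ y
      k<|w| : suc k ≤ length w
      k<|w| = subst (_≤ length w) |x| (subst (length x ≤_) (sym (length-++ x)) (m≤m+n _ _))
      prefix : take (suc k) w ≡ x
      prefix = subst (λ n → take n w ≡ x) |x| (take-++ˡ x (m ++ y))
      suffix : drop (length w ∸ suc k) w ≡ y
      suffix = subst (λ n → drop (length w ∸ n) w ≡ y) |y| (drop-suffix₃ x m y)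

    -- A border of length j + d in a word of length j + 2d overlaps itself;
    -- the overlap is a border of length j.
    border-shorten : ∀ j d w → length w ≡ j + d + d → Border (j + d) w → Border j w
    border-shorten j d w |w| bw = begin
        take j w                    ≡⟨ sym (take-take-≤ w (m≤m+n j d)) ⟩
        take j (take (j + d) w)     ≡⟨ cong (take j) bw′ ⟩
        take j (drop d w)           ≡⟨ cong (λ n → take n (drop d w)) (sym (m+n∸n≡m j d)) ⟩
        take (j + d ∸ d) (drop d w) ≡⟨ sym (drop-take-≤ w (m≤n+m d j)) ⟩
        drop d (take (j + d) w)     ≡⟨ cong (drop d) bw′ ⟩
        drop d (drop d w)           ≡⟨ drop-drop d d w ⟩
        drop (d + d) w              ≡⟨ cong (λ n → drop n w) (sym suffix-start) ⟩
        drop (length w ∸ j) w       ∎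
      where
      open ≡-Reasoning
      bw′ : take (j + d) w ≡ drop d w
      bw′ = trans bw (cong (λ n → drop n w) (trans (cong (_∸ (j + d)) |w|) (m+n∸m≡n (j + d) d)))
      suffix-start : length w ∸ j ≡ d + d
      suffix-start = trans (cong (_∸ j) (trans |w| (+-assoc j d d))) (m+n∸m≡n j (d + d))

    long-border-shortens : ∀ K w → ⌊ length w /2⌋ ≤ K → suc (suc K) ≤ length w →
                           T (border? (suc K) w) → T (hasBorder≤ K w)
    long-border-shortens K w half≤K K+2≤n long =
      hasBorder≤-intro K w (s≤s z≤n) t<K (border-shorten (suc t) d w |w| b)
      where
      n = length w
      d = n ∸ suc K
      K+1+d : suc K + d ≡ n
      K+1+d = m+[n∸m]≡n (≤-trans (n≤1+n (suc K)) K+2≤n)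
      1≤d : 1 ≤ d
      1≤d = +-cancelˡ-≤ (suc K) 1 d
              (subst (_≤ suc K + d) (+-comm 1 (suc K)) (subst (suc (suc K) ≤_) (sym K+1+d) K+2≤n))
      d≤K : d ≤ K
      d≤K = +-cancelˡ-≤ (suc K) d K
              (≤-trans (≤-reflexive K+1+d) (≤-trans (n≤1+⌊n/2⌋+⌊n/2⌋ n) (s≤s (+-mono-≤ half≤K half≤K))))
      t = K ∸ d
      t+d : suc t + d ≡ suc K
      t+d = cong suc (m∸n+n≡m d≤K)
      |w| : length w ≡ suc t + d + d
      |w| = trans (sym K+1+d) (cong (_+ d) (sym t+d))
      b : Border (suc t + d) w
      b = subst (λ j → Border j w) (sym t+d) (border-sound (suc K) w long)
      t<K : suc t ≤ K
      t<K = subst₂ _≤_ (+-comm t 1) (m∸n+n≡m d≤K) (+-monoʳ-≤ t 1≤d)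

    hasBorder≤-half : ∀ w → hasBorder≤ (length w ∸ 1) w ≡ hasBorder≤ ⌊ length w /2⌋ w
    hasBorder≤-half w =
      trans (cong (λ k → hasBorder≤ k w) (sym h+[n-1-h])) (collapse (n ∸ 1 ∸ h) (≤-reflexive h+[n-1-h]))
      where
      n = length w
      h = ⌊ n /2⌋
      h+[n-1-h] : h + (n ∸ 1 ∸ h) ≡ n ∸ 1
      h+[n-1-h] = m+[n∸m]≡n (⌊n/2⌋≤n∸1 n)
      ∨-absorb : ∀ x y → (T y → T x) → x ∨ y ≡ x
      ∨-absorb true y y⇒x = refl
      ∨-absorb false true y⇒x = ⊥-elim (y⇒x tt)
      ∨-absorb false false y⇒x = refl
      K+2≤n : ∀ {K} → suc K ≤ n ∸ 1 → suc (suc K) ≤ n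
      K+2≤n {K} K<n-1 with n
      ... | suc m = s≤s K<n-1
      collapse : ∀ t → h + t ≤ n ∸ 1 → hasBorder≤ (h + t) w ≡ hasBorder≤ h w
      collapse zero _ = cong (λ k → hasBorder≤ k w) (+-identityʳ h)
      collapse (suc t) h+t<n-1 = begin
        hasBorder≤ (h + suc t) w
          ≡⟨ cong (λ k → hasBorder≤ k w) (+-suc h t) ⟩
        hasBorder≤ (suc (h + t)) w
          ≡⟨ ∨-absorb _ _ (long-border-shortens (h + t) w (m≤m+n h t) (K+2≤n h+t<n-1′)) ⟩
        hasBorder≤ (h + t) w
          ≡⟨ collapse t (≤-trans (n≤1+n _) h+t<n-1′) ⟩
        hasBorder≤ h w ∎
        where
        open ≡-Reasoning
        h+t<n-1′ : suc (h + t) ≤ n ∸ 1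
        h+t<n-1′ = subst (_≤ n ∸ 1) (+-suc h t) h+t<n-1

    isInstance? : List A → Bool
    isInstance? U = hasBorder≤ ⌊ (length U ∸ 1) /2⌋ U

    instance⇒border : ∀ U → IsInstanceZ₂ U → T (isInstance? U)
    instance⇒border U ([] , Y , X≢[] , Y≢[] , eq) = ⊥-elim (X≢[] refl)
    instance⇒border U (X@(_ ∷ _) , [] , X≢[] , Y≢[] , eq) = ⊥-elim (Y≢[] refl)
    instance⇒border U (X@(_ ∷ X′) , Y@(_ ∷ Y′) , _ , _ , refl) =
      hasBorder≤-intro _ U (s≤s z≤n) |X|≤half (trans (take-++ˡ X (Y ++ X)) (sym (drop-suffix₃ X Y X)))
      where
      -- |U| - 1 = |X′| + |Y| + |X| ≥ 2|X| since Y is nonempty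
      2|X|≤|U|-1 : length X + length X ≤ length U ∸ 1
      2|X|≤|U|-1 = begin
        suc (length X′) + length X         ≡⟨ sym (+-suc (length X′) (length X)) ⟩
        length X′ + suc (length X)         ≤⟨ +-monoʳ-≤ (length X′) (s≤s (m≤n+m (length X) (length Y′))) ⟩
        length X′ + (length Y + length X)  ≡⟨ cong (length X′ +_) (sym (length-++ Y)) ⟩
        length X′ + length (Y ++ X)        ≡⟨ sym (length-++ X′) ⟩
        length (X′ ++ Y ++ X)              ∎
        where open ≤-Reasoning
      |X|≤half : length X ≤ ⌊ (length U ∸ 1) /2⌋
      |X|≤half = subst (_≤ ⌊ (length U ∸ 1) /2⌋) (sym (n≡⌊n+n/2⌋ (length X))) (⌊n/2⌋-mono 2|X|≤|U|-1)

    border⇒instance : ∀ U → T (isInstance? U) → IsInstanceZ₂ U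
    border⇒instance U t with hasBorder≤-elim _ U t
    ... | j , 1≤j , j≤half , border = X , Y , X≢[] , Y≢[] , U≡XYX
      where
      open ≡-Reasoning
      n = length U
      m = n ∸ (j + j)
      X = take j U
      Y = take m (drop j U)
      2j≤n : j + j ≤ n
      2j≤n = ≤-trans (n≤1+n _) (2j<n n 1≤j j≤half)
      j+m : j + m ≡ n ∸ j
      j+m = sym (trans (cong (_∸ j) (trans (sym (m+[n∸m]≡n 2j≤n)) (+-assoc j j m))) (m+n∸m≡n j (j + m)))
      U≡XYX : U ≡ X ++ Y ++ X
      U≡XYX = begin
        U                           ≡⟨ sym (take++drop≡id j U) ⟩
        X ++ drop j U               ≡⟨ cong (X ++_) (sym (take++drop≡id m (drop j U))) ⟩
        X ++ Y ++ drop m (drop j U) ≡⟨ cong (λ v → X ++ Y ++ v) (drop-drop j m U) ⟩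
        X ++ Y ++ drop (j + m) U    ≡⟨ cong (λ k → X ++ Y ++ drop k U) j+m ⟩
        X ++ Y ++ drop (n ∸ j) U    ≡⟨ cong (λ v → X ++ Y ++ v) (sym border) ⟩
        X ++ Y ++ X                 ∎
      X≢[] : X ≢ []
      X≢[] = nonempty X (subst (1 ≤_) (sym (length-take-≤ U (≤-trans (m≤m+n j j) 2j≤n))) 1≤j)
      1≤m : 1 ≤ m
      1≤m = subst (_≤ m) (m+n∸n≡m 1 (j + j)) (∸-monoˡ-≤ (j + j) (2j<n n 1≤j j≤half))
      m≤|drop| : m ≤ length (drop j U)
      m≤|drop| = subst (m ≤_) (trans j+m (sym (length-drop j U))) (m≤n+m m j)
      Y≢[] : Y ≢ []
      Y≢[] = nonempty Y (subst (1 ≤_) (sym (length-take-≤ (drop j U) m≤|drop|)) 1≤m)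

  𝟙 : Bool → ℕ
  𝟙 true = 1
  𝟙 false = 0

  𝟙-∧ : ∀ x y → 𝟙 (x ∧ y) ≡ 𝟙 x * 𝟙 y
  𝟙-∧ true y = sym (+-identityʳ (𝟙 y))
  𝟙-∧ false y = refl

  𝟙-∨ : ∀ x y → 𝟙 (x ∨ y) ≡ 𝟙 x + 𝟙 (not x ∧ y)
  𝟙-∨ true y = refl
  𝟙-∨ false y = refl

  𝟙-not : ∀ x → 𝟙 (not x) + 𝟙 x ≡ 1
  𝟙-not true = refl
  𝟙-not false = refl

  sum-const : ∀ k c → sum {k} (λ _ → c) ≡ k * c
  sum-const zero c = refl
  sum-const (suc k) c = cong (c +_) (sum-const k c)

  sum-point : ∀ {k} (a : Fin k) → sum (λ b → 𝟙 (does (a Fin.≟ b))) ≡ 1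
  sum-point {suc k} zero = cong suc (trans (sum-const k 0) (*-zeroʳ k))
  sum-point (suc a) = sum-point a

  Σ-Fin↔sum : ∀ k (f : Fin k → ℕ) → Σ (Fin k) (Fin ∘ f) ↔ Fin (sum f)
  Σ-Fin↔sum zero f = mk↔ₛ′ (λ ()) (λ ()) (λ ()) (λ ())
  Σ-Fin↔sum (suc k) f =
    ↔-trans split (↔-trans (↔-refl ⊎-↔ Σ-Fin↔sum k (f ∘ suc)) (↔-sym Fin.+↔⊎))
    where
    split : Σ (Fin (suc k)) (Fin ∘ f) ↔ (Fin (f zero) ⊎ Σ (Fin k) (Fin ∘ f ∘ suc))
    split = mk↔ₛ′ (λ { (zero , x) → inj₁ x ; (suc i , x) → inj₂ (i , x) })
                  (λ { (inj₁ x) → zero , x ; (inj₂ (i , x)) → suc i , x })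
                  (λ { (inj₁ x) → refl ; (inj₂ (i , x)) → refl })
                  (λ { (zero , x) → refl ; (suc i , x) → refl })

  module Counting (q : ℕ) where

    count : ℕ → (List (Fin q) → ℕ) → ℕ
    count zero g = g []
    count (suc n) g = sum (λ a → count n (λ w → g (a ∷ w)))

    count-cong : ∀ n {g h : List (Fin q) → ℕ} → (∀ w → length w ≡ n → g w ≡ h w) → count n g ≡ count n h
    count-cong zero g≗h = g≗h [] refl
    count-cong (suc n) g≗h = sum-cong-≗ (λ a → count-cong n (λ w |w| → g≗h (a ∷ w) (cong suc |w|)))

    count-+ : ∀ n (g h : List (Fin q) → ℕ) → count n (λ w → g w + h w) ≡ count n g + count n h
    count-+ zero g h = refl
    count-+ (suc n) g h = trans (sum-cong-≗ (λ a → count-+ n (λ w → g (a ∷ w)) (λ w → h (a ∷ w))))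
                                  (∑-distrib-+ (λ a → count n (λ w → g (a ∷ w))) (λ a → count n (λ w → h (a ∷ w))))

    count-* : ∀ n c (g : List (Fin q) → ℕ) → count n (λ w → c * g w) ≡ c * count n g
    count-* zero c g = refl
    count-* (suc n) c g = trans (sum-cong-≗ (λ a → count-* n c (λ w → g (a ∷ w))))
                                (sym (*-distribˡ-sum c (λ a → count n (λ w → g (a ∷ w)))))

    count-const : ∀ n c → count n (λ _ → c) ≡ q ^ n * c
    count-const zero c = sym (+-identityʳ c)
    count-const (suc n) c = begin
        sum {q} (λ _ → count n (λ _ → c)) ≡⟨ sum-cong-≗ {q} (λ _ → count-const n c) ⟩
        sum {q} (λ _ → q ^ n * c)         ≡⟨ sum-const q (q ^ n * c) ⟩
        q * (q ^ n * c)                   ≡⟨ sym (*-assoc q (q ^ n) c) ⟩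
        q * q ^ n * c                     ∎
      where open ≡-Reasoning

    count-++ : ∀ m r (g : List (Fin q) → ℕ) → count (m + r) g ≡ count m (λ x → count r (λ y → g (x ++ y)))
    count-++ zero r g = refl
    count-++ (suc m) r g = sum-cong-≗ (λ a → count-++ m r (λ w → g (a ∷ w)))

    open Borders (Fin._≟_ {q})

    count-point : ∀ x → count (length x) (λ y → 𝟙 (does (x ≟ₗ y))) ≡ 1
    count-point [] = refl
    count-point (a ∷ x) = trans (sum-cong-≗ λ b → begin
        count (length x) (λ y → 𝟙 (does (a Fin.≟ b) ∧ does (x ≟ₗ y)))
          ≡⟨ count-cong (length x) (λ y _ → 𝟙-∧ (does (a Fin.≟ b)) (does (x ≟ₗ y))) ⟩
        count (length x) (λ y → 𝟙 (does (a Fin.≟ b)) * 𝟙 (does (x ≟ₗ y)))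
          ≡⟨ count-* (length x) (𝟙 (does (a Fin.≟ b))) (λ y → 𝟙 (does (x ≟ₗ y))) ⟩
        𝟙 (does (a Fin.≟ b)) * count (length x) (λ y → 𝟙 (does (x ≟ₗ y)))
          ≡⟨ cong (𝟙 (does (a Fin.≟ b)) *_) (count-point x) ⟩
        𝟙 (does (a Fin.≟ b)) * 1
          ≡⟨ *-identityʳ _ ⟩
        𝟙 (does (a Fin.≟ b)) ∎)
      (sum-point a)
      where open ≡-Reasoning

    words↔count : ∀ n (p : List (Fin q) → Bool) →
                  Σ (Word q n) (λ v → T (p (toList v))) ↔ Fin (count n (𝟙 ∘ p))
    words↔count zero p with p [] in eq
    ... | true = mk↔ₛ′ (λ _ → zero) (λ _ → []ᵥ , subst T (sym eq) tt)
                       (λ { zero → refl }) (λ { ([]ᵥ , t) → cong ([]ᵥ ,_) (T-irrelevant _ t) })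
    ... | false = mk↔ₛ′ (λ { ([]ᵥ , t) → ⊥-elim (subst T eq t) }) (λ ())
                        (λ ()) (λ { ([]ᵥ , t) → ⊥-elim (subst T eq t) })
    words↔count (suc n) p =
      ↔-trans uncons (↔-trans (Σ-↔ ↔-refl (λ {a} → words↔count n (λ w → p (a ∷ w)))) (Σ-Fin↔sum q _))
      where
      uncons : Σ (Word q (suc n)) (λ v → T (p (toList v))) ↔
               Σ (Fin q) (λ a → Σ (Word q n) (λ v → T (p (a ∷ toList v))))
      uncons = mk↔ₛ′ (λ { ((a ∷ᵥ v) , t) → a , v , t }) (λ { (a , v , t) → (a ∷ᵥ v) , t })
                     (λ _ → refl) (λ { ((a ∷ᵥ v) , t) → refl })

    numInstances≡count : ∀ n c → NumInstances q n c → c ≡ count n (𝟙 ∘ isInstance?)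
    numInstances≡count n c (f , f-inj , f-inst , f-onto) = ↔⇒≡ (↔-trans enum (words↔count n isInstance?))
      where
      index : Σ (Word q n) (λ v → T (isInstance? (toList v))) → Fin c
      index (v , t) = proj₁ (f-onto v (border⇒instance _ t))
      enum : Fin c ↔ Σ (Word q n) (λ v → T (isInstance? (toList v)))
      enum = mk↔ₛ′ (λ i → f i , instance⇒border _ (f-inst i)) index
        (λ { (v , t) → let (_ , eq) = f-onto v (border⇒instance _ t) in
                       Σ-≡ eq })
        (λ i → f-inj (proj₂ (f-onto (f i) (border⇒instance _ (instance⇒border _ (f-inst i))))))
        where
        Σ-≡ : ∀ {v v′} {t : T (isInstance? (toList v))} {t′ : T (isInstance? (toList v′))} →
              v ≡ v′ → _≡_ {A = Σ (Word q n) (λ v → T (isInstance? (toList v)))} (v , t) (v′ , t′)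
        Σ-≡ {v} refl = cong (v ,_) (T-irrelevant _ _)

    u : ℕ → ℕ
    u b = count b (𝟙 ∘ unbordered)

    -- C n K = Σ_{b=1}^{K} u_b q^(n-2b): a word of length n ≥ 2K whose shortest
    -- border has length b ≤ K is an unbordered word x of length b, then an
    -- arbitrary middle of length n - 2b, then x again.
    C : ℕ → ℕ → ℕ
    C n zero = 0
    C n (suc K) = C n K + u (suc K) * q ^ (n ∸ (suc K + suc K))

    count-shortestBorder : ∀ k r → count (suc k + (r + suc k)) (𝟙 ∘ shortestBorder k) ≡ u (suc k) * q ^ r
    count-shortestBorder k r = begin
        count (b + (r + b)) (𝟙 ∘ shortestBorder k)
          ≡⟨ count-++ b (r + b) (𝟙 ∘ shortestBorder k) ⟩
        count b (λ x → count (r + b) (λ z → 𝟙 (shortestBorder k (x ++ z))))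
          ≡⟨ count-cong b (λ x _ → count-++ r b (λ z → 𝟙 (shortestBorder k (x ++ z)))) ⟩
        count b (λ x → count r (λ m → count b (λ y → 𝟙 (shortestBorder k (x ++ m ++ y)))))
          ≡⟨ count-cong b (λ x |x| → count-cong r (λ m _ → fixed-x x |x| m)) ⟩
        count b (λ x → count r (λ _ → 𝟙 (unbordered x)))
          ≡⟨ count-cong b (λ x _ → count-const r (𝟙 (unbordered x))) ⟩
        count b (λ x → q ^ r * 𝟙 (unbordered x))
          ≡⟨ count-* b (q ^ r) (𝟙 ∘ unbordered) ⟩
        q ^ r * u b
          ≡⟨ *-comm (q ^ r) (u b) ⟩
        u b * q ^ r ∎
      where
      open ≡-Reasoning
      b = suc k
      -- for fixed x and middle m, only y = x contributes, and only if x is unbordered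
      fixed-x : ∀ x → length x ≡ b → ∀ m → count b (λ y → 𝟙 (shortestBorder k (x ++ m ++ y))) ≡ 𝟙 (unbordered x)
      fixed-x x |x| m = begin
        count b (λ y → 𝟙 (shortestBorder k (x ++ m ++ y)))
          ≡⟨ count-cong b (λ y |y| → trans (cong 𝟙 (shortestBorder-++ k x m y |x| |y|))
                                           (𝟙-∧ (unbordered x) (does (x ≟ₗ y)))) ⟩
        count b (λ y → 𝟙 (unbordered x) * 𝟙 (does (x ≟ₗ y)))
          ≡⟨ count-* b (𝟙 (unbordered x)) (λ y → 𝟙 (does (x ≟ₗ y))) ⟩
        𝟙 (unbordered x) * count b (λ y → 𝟙 (does (x ≟ₗ y)))
          ≡⟨ cong (λ n → 𝟙 (unbordered x) * count n (λ y → 𝟙 (does (x ≟ₗ y)))) (sym |x|) ⟩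
        𝟙 (unbordered x) * count (length x) (λ y → 𝟙 (does (x ≟ₗ y)))
          ≡⟨ cong (𝟙 (unbordered x) *_) (count-point x) ⟩
        𝟙 (unbordered x) * 1
          ≡⟨ *-identityʳ _ ⟩
        𝟙 (unbordered x) ∎

    -- Words with a border of length ≤ K are classified by their shortest border.
    count-hasBorder≤ : ∀ n K → K + K ≤ n → count n (𝟙 ∘ hasBorder≤ K) ≡ C n K
    count-hasBorder≤ n zero _ = trans (count-const n 0) (*-zeroʳ (q ^ n))
    count-hasBorder≤ n (suc K) 2K+2≤n = begin
        count n (𝟙 ∘ hasBorder≤ (suc K))
          ≡⟨ count-cong n (λ w _ → 𝟙-∨ (hasBorder≤ K w) (border? (suc K) w)) ⟩
        count n (λ w → 𝟙 (hasBorder≤ K w) + 𝟙 (shortestBorder K w))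
          ≡⟨ count-+ n (𝟙 ∘ hasBorder≤ K) (𝟙 ∘ shortestBorder K) ⟩
        count n (𝟙 ∘ hasBorder≤ K) + count n (𝟙 ∘ shortestBorder K)
          ≡⟨ cong₂ _+_ (count-hasBorder≤ n K (≤-trans (+-mono-≤ (n≤1+n K) (n≤1+n K)) 2K+2≤n))
                       (trans (cong (λ m → count m (𝟙 ∘ shortestBorder K)) n≡) (count-shortestBorder K r)) ⟩
        C n K + u (suc K) * q ^ r ∎
      where
      open ≡-Reasoning
      r = n ∸ (suc K + suc K)
      n≡ : n ≡ suc K + (r + suc K)
      n≡ = sym (trans (cong (suc K +_) (+-comm r (suc K)))
                      (trans (sym (+-assoc (suc K) (suc K) r)) (m+[n∸m]≡n 2K+2≤n)))

    -- Every word is unbordered or has a border of length ≤ n/2.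
    all-words : ∀ n → q ^ n ≡ u n + C n ⌊ n /2⌋
    all-words n = begin
        q ^ n
          ≡⟨ sym (*-identityʳ (q ^ n)) ⟩
        q ^ n * 1
          ≡⟨ sym (count-const n 1) ⟩
        count n (λ _ → 1)
          ≡⟨ count-cong n split ⟩
        count n (λ w → 𝟙 (unbordered w) + 𝟙 (hasBorder≤ ⌊ n /2⌋ w))
          ≡⟨ count-+ n (𝟙 ∘ unbordered) (𝟙 ∘ hasBorder≤ ⌊ n /2⌋) ⟩
        u n + count n (𝟙 ∘ hasBorder≤ ⌊ n /2⌋)
          ≡⟨ cong (u n +_) (count-hasBorder≤ n ⌊ n /2⌋ (⌊n/2⌋+⌊n/2⌋≤n n)) ⟩
        u n + C n ⌊ n /2⌋ ∎
      where
      open ≡-Reasoning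
      split : ∀ w → length w ≡ n → 1 ≡ 𝟙 (unbordered w) + 𝟙 (hasBorder≤ ⌊ n /2⌋ w)
      split w refl = trans (sym (𝟙-not (hasBorder≤ (length w ∸ 1) w)))
                           (cong (λ b → 𝟙 (unbordered w) + 𝟙 b) (hasBorder≤-half w))

    count-instances : ∀ n → count n (𝟙 ∘ isInstance?) ≡ C n ⌊ (n ∸ 1) /2⌋
    count-instances n =
      trans (count-cong n (λ w |w| → cong (λ m → 𝟙 (hasBorder≤ ⌊ (m ∸ 1) /2⌋ w)) |w|))
            (count-hasBorder≤ n ⌊ (n ∸ 1) /2⌋ (≤-trans (⌊n/2⌋+⌊n/2⌋≤n (n ∸ 1)) (m∸n≤m n 1)))

module Analysis where

  open import Data.Empty using (⊥-elim)
  open import Data.Integer as ℤ using (+_; -[1+_])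
  import Data.Integer.Properties as ℤ
  open import Data.Nat as ℕ using (zero; suc; s≤s; z≤n; ⌊_/2⌋)
  import Data.Nat.Properties as ℕ
  open import Data.Nat.Coprimality using (1-coprimeTo)
  import Data.Nat.Coprimality as Coprime
  open import Data.Sum using (_⊎_; inj₁; inj₂)
  open import Data.Product using (proj₁; proj₂)
  open import Data.Rational
    using (mkℚ; 1ℚ; ½; ≢-nonZero; nonNegative; positive; _+_; _*_; -_; _≤_; *≤*; *<*; _≤?_; _<?_; _/_)
  open import Data.Rational.Properties
  open import Data.Rational.Solver using (module +-*-Solver)
  open import Relation.Binary.PropositionalEquality
  open import Relation.Nullary using (yes; no)
  open import Relation.Nullary.Decidable using (toWitness)
  open +-*-Solver

  recip-inverse : ∀ p → p ≢ 0ℚ → p * recip p ≡ 1ℚ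
  recip-inverse p p≢0 with p ≟ 0ℚ
  ... | yes p≡0 = ⊥-elim (p≢0 p≡0)
  ... | no p≢0′ = *-inverseʳ p {{≢-nonZero p≢0′}}

  *≡1⇒≢0 : ∀ p r → p * r ≡ 1ℚ → p ≢ 0ℚ
  *≡1⇒≢0 p r pr≡1 p≡0 = 1≢0 (trans (sym pr≡1) (trans (cong (_* r) p≡0) (*-zeroˡ r)))

  recip-unique : ∀ p r → p * r ≡ 1ℚ → recip p ≡ r
  recip-unique p r pr≡1 = begin
      recip p           ≡⟨ sym (*-identityʳ (recip p)) ⟩
      recip p * 1ℚ      ≡⟨ cong (recip p *_) (sym pr≡1) ⟩
      recip p * (p * r) ≡⟨ sym (*-assoc (recip p) p r) ⟩
      recip p * p * r   ≡⟨ cong (_* r) (trans (*-comm (recip p) p) (recip-inverse p (*≡1⇒≢0 p r pr≡1))) ⟩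
      1ℚ * r            ≡⟨ *-identityˡ r ⟩
      r                 ∎
    where open ≡-Reasoning

  recip-* : ∀ p r → p ≢ 0ℚ → r ≢ 0ℚ → recip (p * r) ≡ recip p * recip r
  recip-* p r p≢0 r≢0 = recip-unique (p * r) (recip p * recip r) (begin
      p * r * (recip p * recip r)       ≡⟨ solve 4 (λ p r s t → (p :* r) :* (s :* t) := (p :* s) :* (r :* t))
                                                   refl p r (recip p) (recip r) ⟩
      p * recip p * (r * recip r)       ≡⟨ cong₂ _*_ (recip-inverse p p≢0) (recip-inverse r r≢0) ⟩
      1ℚ                                ∎)
    where open ≡-Reasoning

  ^-+ : ∀ p m n → p ^ℕ (m ℕ.+ n) ≡ p ^ℕ m * p ^ℕ n
  ^-+ p zero n = sym (*-identityˡ _)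
  ^-+ p (suc m) n = trans (cong (p *_) (^-+ p m n)) (sym (*-assoc p _ _))

  ^-* : ∀ p r n → (p * r) ^ℕ n ≡ p ^ℕ n * r ^ℕ n
  ^-* p r zero = refl
  ^-* p r (suc n) = trans (cong ((p * r) *_) (^-* p r n))
    (solve 4 (λ p r a b → (p :* r) :* (a :* b) := (p :* a) :* (r :* b)) refl p r (p ^ℕ n) (r ^ℕ n))

  1^ : ∀ n → 1ℚ ^ℕ n ≡ 1ℚ
  1^ zero = refl
  1^ (suc n) = trans (*-identityˡ _) (1^ n)

  ^-inverse : ∀ p r n → p * r ≡ 1ℚ → p ^ℕ n * r ^ℕ n ≡ 1ℚ
  ^-inverse p r n pr≡1 = trans (sym (^-* p r n)) (trans (cong (_^ℕ n) pr≡1) (1^ n))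

  fromℕ≡mkℚ : ∀ n → fromℕ n ≡ mkℚ (+ n) 0 (Coprime.sym (1-coprimeTo n))
  fromℕ≡mkℚ n = ↥p/↧p≡p (mkℚ (+ n) 0 (Coprime.sym (1-coprimeTo n)))

  fromℕ-+ : ∀ m n → fromℕ (m ℕ.+ n) ≡ fromℕ m + fromℕ n
  fromℕ-+ m n = trans
    (cong (_/ 1) (trans (ℤ.pos-+ m n) (sym (cong₂ ℤ._+_ (ℤ.*-identityʳ (+ m)) (ℤ.*-identityʳ (+ n))))))
    (sym (cong₂ _+_ (fromℕ≡mkℚ m) (fromℕ≡mkℚ n)))

  fromℕ-* : ∀ m n → fromℕ (m ℕ.* n) ≡ fromℕ m * fromℕ n
  fromℕ-* m n = trans (cong (_/ 1) (ℤ.pos-* m n)) (sym (cong₂ _*_ (fromℕ≡mkℚ m) (fromℕ≡mkℚ n)))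

  fromℕ-^ : ∀ m n → fromℕ (m ℕ.^ n) ≡ fromℕ m ^ℕ n
  fromℕ-^ m zero = refl
  fromℕ-^ m (suc n) = trans (fromℕ-* m (m ℕ.^ n)) (cong (fromℕ m *_) (fromℕ-^ m n))

  fromℕ-mono : ∀ {m n} → m ℕ.≤ n → fromℕ m ≤ fromℕ n
  fromℕ-mono {m} {n} m≤n = subst₂ _≤_ (sym (fromℕ≡mkℚ m)) (sym (fromℕ≡mkℚ n))
    (*≤* (subst₂ ℤ._≤_ (sym (ℤ.*-identityʳ (+ m))) (sym (ℤ.*-identityʳ (+ n))) (ℤ.+≤+ m≤n)))

  fromℕ-nonneg : ∀ n → 0ℚ ≤ fromℕ n
  fromℕ-nonneg n = fromℕ-mono {0} {n} z≤n

  *-monoˡ-≤′ : ∀ {r p s} → 0ℚ ≤ r → p ≤ s → r * p ≤ r * s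
  *-monoˡ-≤′ {r} 0≤r = *-monoˡ-≤-nonNeg r {{nonNegative 0≤r}}

  *-monoʳ-≤′ : ∀ {r p s} → 0ℚ ≤ r → p ≤ s → p * r ≤ s * r
  *-monoʳ-≤′ {r} 0≤r = *-monoʳ-≤-nonNeg r {{nonNegative 0≤r}}

  *-nonneg : ∀ {p r} → 0ℚ ≤ p → 0ℚ ≤ r → 0ℚ ≤ p * r
  *-nonneg {p} {r} 0≤p 0≤r = subst (_≤ p * r) (*-zeroʳ p) (*-monoˡ-≤′ 0≤p 0≤r)

  *-mono-nonneg : ∀ {a b c d} → 0ℚ ≤ a → 0ℚ ≤ c → a ≤ b → c ≤ d → a * c ≤ b * d
  *-mono-nonneg 0≤a 0≤c a≤b c≤d =
    ≤-trans (*-monoˡ-≤′ 0≤a c≤d) (*-monoʳ-≤′ (≤-trans 0≤c c≤d) a≤b)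

  ^-nonneg : ∀ {p} n → 0ℚ ≤ p → 0ℚ ≤ p ^ℕ n
  ^-nonneg zero 0≤p = toWitness {a? = 0ℚ ≤? 1ℚ} _
  ^-nonneg (suc n) 0≤p = *-nonneg 0≤p (^-nonneg n 0≤p)

  ^-mono : ∀ {p r} n → 0ℚ ≤ p → p ≤ r → p ^ℕ n ≤ r ^ℕ n
  ^-mono zero 0≤p p≤r = ≤-refl
  ^-mono (suc n) 0≤p p≤r = *-mono-nonneg 0≤p (^-nonneg n 0≤p) p≤r (^-mono n 0≤p p≤r)

  ½^ : ℕ → ℚ
  ½^ n = ½ ^ℕ n

  ½^-nonneg : ∀ n → 0ℚ ≤ ½^ n
  ½^-nonneg n = ^-nonneg n (toWitness {a? = 0ℚ ≤? ½} _)

  ½^≤1 : ∀ n → ½^ n ≤ 1ℚ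
  ½^≤1 n = subst (½^ n ≤_) (1^ n) (^-mono n (toWitness {a? = 0ℚ ≤? ½} _) (toWitness {a? = ½ ≤? 1ℚ} _))

  ½^-anti : ∀ {m n} → m ℕ.≤ n → ½^ n ≤ ½^ m
  ½^-anti {m} {n} m≤n = begin
      ½^ n               ≡⟨ cong ½^ (sym (ℕ.m+[n∸m]≡n m≤n)) ⟩
      ½^ (m ℕ.+ (n ℕ.∸ m)) ≡⟨ ^-+ ½ m (n ℕ.∸ m) ⟩
      ½^ m * ½^ (n ℕ.∸ m) ≤⟨ *-monoˡ-≤′ (½^-nonneg m) (½^≤1 (n ℕ.∸ m)) ⟩
      ½^ m * 1ℚ          ≡⟨ *-identityʳ (½^ m) ⟩
      ½^ m               ∎
    where open ≤-Reasoning

  n*½^n≤1 : ∀ n → fromℕ n * ½^ n ≤ 1ℚ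
  n*½^n≤1 zero = toWitness {a? = 0ℚ * 1ℚ ≤? 1ℚ} _
  n*½^n≤1 (suc n) = begin
      fromℕ (suc n) * ½^ (suc n)
        ≡⟨ cong (_* ½^ (suc n)) (fromℕ-+ 1 n) ⟩
      (1ℚ + fromℕ n) * (½ * ½^ n)
        ≡⟨ solve 2 (λ j h → (con 1ℚ :+ j) :* (con ½ :* h) := con ½ :* (h :+ j :* h))
                  refl (fromℕ n) (½^ n) ⟩
      ½ * (½^ n + fromℕ n * ½^ n)
        ≤⟨ *-monoˡ-≤-nonNeg ½ (+-mono-≤ (½^≤1 n) (n*½^n≤1 n)) ⟩
      ½ * (1ℚ + 1ℚ)
        ≡⟨⟩
      1ℚ ∎
    where open ≤-Reasoning

  ½^≡1/2^ : ∀ t → ∃[ d ] (suc d ≡ 2 ℕ.^ t × ½^ t ≡ mkℚ (+ 1) d (1-coprimeTo (suc d)))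
  ½^≡1/2^ zero = 0 , refl , refl
  ½^≡1/2^ (suc t) with ½^≡1/2^ t
  ... | d , 2^t , ½^t = d ℕ.+ suc (d ℕ.+ 0) , cong (2 ℕ.*_) 2^t ,
        trans (cong (½ *_) ½^t) (↥p/↧p≡p (mkℚ (+ 1) (d ℕ.+ suc (d ℕ.+ 0)) (1-coprimeTo _)))

  n<2^n : ∀ n → suc n ℕ.≤ 2 ℕ.^ n
  n<2^n zero = s≤s z≤n
  n<2^n (suc n) = ℕ.+-mono-≤ (ℕ.≤-trans (s≤s z≤n) (n<2^n n))
                    (ℕ.≤-trans (n<2^n n) (ℕ.≤-reflexive (sym (ℕ.+-identityʳ _))))

  -- Archimedean property: ½ᵗ is eventually below any positive rational;
  -- for ε = (k+1)/(d+1) take t = d + 1.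
  ½^-small : ∀ ε → 0ℚ < ε → ∃[ t ] ½^ t < ε
  ½^-small (mkℚ (+ zero) _ _) (*<* (ℤ.+<+ ()))
  ½^-small (mkℚ -[1+ _ ] _ _) (*<* ())
  ½^-small ε@(mkℚ (+ suc k) d _) _ with ½^≡1/2^ (suc d)
  ... | d′ , 2^d+1 , ½^d+1 = suc d , subst (_< ε) (sym ½^d+1)
          (*<* (subst₂ ℤ._<_ (ℤ.pos-* 1 (suc d)) (ℤ.pos-* (suc k) (suc d′)) (ℤ.+<+ cross)))
    where
    cross : suc (1 ℕ.* suc d) ℕ.≤ suc k ℕ.* suc d′
    cross = ℕ.≤-trans (s≤s (ℕ.≤-reflexive (ℕ.+-identityʳ (suc d))))
              (ℕ.≤-trans (n<2^n (suc d)) (ℕ.≤-trans (ℕ.≤-reflexive (sym 2^d+1)) (ℕ.m≤n*m (suc d′) (suc k))))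

  ¼ two four : ℚ
  ¼ = + 1 / 4
  two = fromℕ 2
  four = fromℕ 4

  0≤two : 0ℚ ≤ two
  0≤two = toWitness {a? = 0ℚ ≤? two} _

  0≤four : 0ℚ ≤ four
  0≤four = toWitness {a? = 0ℚ ≤? four} _

  recip-¼ : ∀ d → ¼ ≤ d → d * recip d ≡ 1ℚ × 0ℚ ≤ recip d × recip d ≤ four
  recip-¼ d ¼≤d = d*r≡1 , 0≤r , r≤4
    where
    d>0 : 0ℚ < d
    d>0 = <-≤-trans (toWitness {a? = 0ℚ <? ¼} _) ¼≤d
    d*r≡1 : d * recip d ≡ 1ℚ
    d*r≡1 = recip-inverse d (λ d≡0 → <-irrefl (sym d≡0) d>0)
    0≤r : 0ℚ ≤ recip d
    0≤r = ≮⇒≥ λ r<0 → <-asym (toWitness {a? = 0ℚ <? 1ℚ} _)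
            (subst₂ _<_ d*r≡1 (*-zeroʳ d) (*-monoʳ-<-pos d {{positive d>0}} r<0))
    -- 1/d > 4 would give 1 = d · (1/d) > 4d ≥ 1
    r≤4 : recip d ≤ four
    r≤4 = ≮⇒≥ λ 4<r → <-irrefl refl (≤-<-trans
            (≤-trans (toWitness {a? = 1ℚ ≤? ¼ * four} _) (*-monoʳ-≤′ 0≤four ¼≤d))
            (subst (d * four <_) d*r≡1 (*-monoʳ-<-pos d {{positive d>0}} 4<r)))

  module Exponents (q : ℕ) (q≥2 : 2 ℕ.≤ q) where

    Q : ℚ
    Q = fromℕ q

    x : ℚ
    x = recip Q

    Q>0 : 0ℚ < Q
    Q>0 = <-≤-trans (toWitness {a? = 0ℚ <? two} _) (fromℕ-mono q≥2)

    Q*x : Q * x ≡ 1ℚ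
    Q*x = recip-inverse Q (λ Q≡0 → <-irrefl (sym Q≡0) Q>0)

    Qⁿxⁿ : ∀ n → Q ^ℕ n * x ^ℕ n ≡ 1ℚ
    Qⁿxⁿ n = ^-inverse Q x n Q*x

    x-nonneg : 0ℚ ≤ x
    x-nonneg = ≮⇒≥ (λ x<0 → <-asym (toWitness {a? = 0ℚ <? 1ℚ} _)
                 (subst₂ _<_ Q*x (*-zeroʳ Q) (*-monoʳ-<-pos Q {{positive Q>0}} x<0)))

    x≤½ : x ≤ ½
    x≤½ = begin
        x                  ≡⟨ solve 1 (λ x → x := con ½ :* (con two :* x)) refl x ⟩
        ½ * (two * x)  ≤⟨ *-monoˡ-≤-nonNeg ½ (*-monoʳ-≤′ x-nonneg (fromℕ-mono q≥2)) ⟩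
        ½ * (Q * x)        ≡⟨ cong (½ *_) Q*x ⟩
        ½                  ∎
      where open ≤-Reasoning

    e≡recip : ∀ k t → 2 ℕ.^ suc k ≡ suc (suc t) → e q k ≡ recip (Q ^ℕ suc t)
    e≡recip k t 2^k+1 = cong (λ n → Q ^ℤ ((+ 1) ℤ.- (+ n))) 2^k+1

    e-zero : e q 0 ≡ x
    e-zero = trans (e≡recip 0 0 refl) (cong recip (*-identityʳ Q))

    2^[k+1]≥2 : ∀ k → ∃[ t ] 2 ℕ.^ suc k ≡ suc (suc t)
    2^[k+1]≥2 zero = 0 , refl
    2^[k+1]≥2 (suc k) with 2^[k+1]≥2 k
    ... | t , eq = t ℕ.+ suc (suc (t ℕ.+ 0)) , cong (2 ℕ.*_) eq

    e-suc : ∀ k → e q (suc k) ≡ x * (e q k * e q k)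
    e-suc k with 2^[k+1]≥2 k
    ... | t , eq = begin
        e q (suc k)
          ≡⟨ e≡recip (suc k) (t ℕ.+ suc (suc (t ℕ.+ 0))) (cong (2 ℕ.*_) eq) ⟩
        recip (Q ^ℕ suc (t ℕ.+ suc (suc (t ℕ.+ 0))))
          ≡⟨ cong (λ n → recip (Q ^ℕ suc n)) exponent ⟩
        recip (Q * Q ^ℕ (suc t ℕ.+ suc t))
          ≡⟨ cong (λ r → recip (Q * r)) (^-+ Q (suc t) (suc t)) ⟩
        recip (Q * (A * A))
          ≡⟨ recip-* Q (A * A) (*≡1⇒≢0 Q x Q*x) (subst (_≢ 0ℚ) (^-+ Q (suc t) (suc t)) (Qⁿ≢0 (suc t ℕ.+ suc t))) ⟩
        x * recip (A * A)
          ≡⟨ cong (x *_) (recip-* A A (Qⁿ≢0 (suc t)) (Qⁿ≢0 (suc t))) ⟩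
        x * (recip A * recip A)
          ≡⟨ cong (λ r → x * (r * r)) (sym (e≡recip k t eq)) ⟩
        x * (e q k * e q k) ∎
      where
      open ≡-Reasoning
      A = Q ^ℕ suc t
      Qⁿ≢0 : ∀ n → Q ^ℕ n ≢ 0ℚ
      Qⁿ≢0 n = *≡1⇒≢0 (Q ^ℕ n) (x ^ℕ n) (Qⁿxⁿ n)
      exponent : t ℕ.+ suc (suc (t ℕ.+ 0)) ≡ suc t ℕ.+ suc t
      exponent = trans (ℕ.+-suc t (suc (t ℕ.+ 0))) (cong (λ n → suc (t ℕ.+ suc n)) (ℕ.+-identityʳ t))

    e-nonneg : ∀ k → 0ℚ ≤ e q k
    e-nonneg zero = subst (0ℚ ≤_) (sym e-zero) x-nonneg
    e-nonneg (suc k) = subst (0ℚ ≤_) (sym (e-suc k)) (*-nonneg x-nonneg (*-nonneg (e-nonneg k) (e-nonneg k)))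

    e≤x : ∀ k → e q k ≤ x
    e≤x zero = ≤-reflexive e-zero
    e≤x (suc k) = begin
        e q (suc k)          ≡⟨ e-suc k ⟩
        x * (e q k * e q k)  ≤⟨ *-monoˡ-≤′ x-nonneg
                                  (*-mono-nonneg (e-nonneg k) (e-nonneg k) eₖ≤1 eₖ≤1) ⟩
        x * (1ℚ * 1ℚ)        ≡⟨ *-identityʳ x ⟩
        x                    ∎
      where
      open ≤-Reasoning
      eₖ≤1 = ≤-trans (e≤x k) (≤-trans x≤½ (toWitness {a? = ½ ≤? 1ℚ} _))

    e≤½ : ∀ k → e q k ≤ ½
    e≤½ k = ≤-trans (e≤x k) x≤½

    -- e_{k+1} = x e_k² ≤ ½ e_k
    e-suc≤ : ∀ k → e q (suc k) ≤ ½ * e q k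
    e-suc≤ k = begin
        e q (suc k)          ≡⟨ e-suc k ⟩
        x * (e q k * e q k)  ≤⟨ *-mono-nonneg x-nonneg (*-nonneg (e-nonneg k) (e-nonneg k)) x≤½
                                  (*-monoˡ-≤′ (e-nonneg k)
                                    (≤-trans (e≤½ k) (toWitness {a? = ½ ≤? 1ℚ} _))) ⟩
        ½ * (e q k * 1ℚ)     ≡⟨ cong (½ *_) (*-identityʳ (e q k)) ⟩
        ½ * e q k            ∎
      where open ≤-Reasoning

    e≤½^ : ∀ k → e q k ≤ ½^ (suc k)
    e≤½^ zero = ≤-trans (e≤x 0) (≤-trans x≤½ (≤-reflexive (sym (*-identityʳ ½))))
    e≤½^ (suc k) = ≤-trans (e-suc≤ k) (*-monoˡ-≤-nonNeg ½ (e≤½^ k))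

    e-suc≤½^ : ∀ k → e q (suc k) ≤ ½^ (3 ℕ.+ k)
    e-suc≤½^ zero = begin
        e q 1
          ≡⟨ trans (e-suc 0) (cong (λ r → x * (r * r)) e-zero) ⟩
        x * (x * x)
          ≤⟨ *-mono-nonneg x-nonneg (*-nonneg x-nonneg x-nonneg) x≤½ (*-mono-nonneg x-nonneg x-nonneg x≤½ x≤½) ⟩
        ½^ 3 ∎
      where open ≤-Reasoning
    e-suc≤½^ (suc k) = ≤-trans (e-suc≤ (suc k)) (*-monoˡ-≤-nonNeg ½ (e-suc≤½^ k))

    -- D J = ∏_{k<J} (1 - e_k); the denominators of the series are denom q j = D (j+1).
    D : ℕ → ℚ
    D zero = 1ℚ
    D (suc j) = denom q j

    D-suc : ∀ J → D (suc J) ≡ D J * (1ℚ - e q J)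
    D-suc zero = sym (*-identityˡ _)
    D-suc (suc J) = refl

    1-e-nonneg : ∀ k → 0ℚ ≤ 1ℚ - e q k
    1-e-nonneg k = subst (_≤ 1ℚ - e q k) (+-inverseʳ (e q k))
                     (+-monoˡ-≤ (- e q k) (≤-trans (e≤½ k) (toWitness {a? = ½ ≤? 1ℚ} _)))

    1-e≤1 : ∀ k → 1ℚ - e q k ≤ 1ℚ
    1-e≤1 k = subst (1ℚ - e q k ≤_) (+-identityʳ 1ℚ) (+-monoʳ-≤ 1ℚ (neg-antimono-≤ (e-nonneg k)))

    D-nonneg : ∀ J → 0ℚ ≤ D J
    D-nonneg zero = toWitness {a? = 0ℚ ≤? 1ℚ} _
    D-nonneg (suc J) = subst (0ℚ ≤_) (sym (D-suc J)) (*-nonneg (D-nonneg J) (1-e-nonneg J))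

    D≤1 : ∀ J → D J ≤ 1ℚ
    D≤1 zero = ≤-refl
    D≤1 (suc J) = subst (_≤ 1ℚ) (sym (D-suc J))
      (*-mono-nonneg (D-nonneg J) (1-e-nonneg J) (D≤1 J) (1-e≤1 J))

    D-step : ∀ J → D J - e q J ≤ D (suc J)
    D-step J = begin
        D J - e q J         ≤⟨ +-monoʳ-≤ (D J) (neg-antimono-≤ (subst (_≤ e q J) (*-comm (e q J) (D J))
                                 (≤-trans (*-monoˡ-≤′ (e-nonneg J) (D≤1 J))
                                          (≤-reflexive (*-identityʳ _))))) ⟩
        D J - D J * e q J   ≡⟨ solve 2 (λ d e → d :- d :* e := d :* (con 1ℚ :- e)) refl (D J) (e q J) ⟩
        D J * (1ℚ - e q J)  ≡⟨ sym (D-suc J) ⟩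
        D (suc J)           ∎
      where open ≤-Reasoning

    -- D_{k+1} ≥ 1 - ½ - ⅛ - … - ½^(k+2) = ¼ + ½^(k+2)
    D-suc≥ : ∀ k → ¼ + ½^ (2 ℕ.+ k) ≤ D (suc k)
    D-suc≥ zero = begin
        ¼ + ½^ 2     ≡⟨⟩
        1ℚ - ½       ≤⟨ +-monoʳ-≤ 1ℚ (neg-antimono-≤ (subst (_≤ ½) (sym e-zero) x≤½)) ⟩
        1ℚ - e q 0   ≡⟨⟩
        D 1          ∎
      where open ≤-Reasoning
    D-suc≥ (suc k) = begin
        ¼ + ½^ (3 ℕ.+ k)                     ≡⟨ solve 2 (λ a h → a :+ con ½ :* h := (a :+ h) :- con ½ :* h)
                                                         refl ¼ (½^ (2 ℕ.+ k)) ⟩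
        (¼ + ½^ (2 ℕ.+ k)) - ½^ (3 ℕ.+ k)    ≤⟨ +-mono-≤ (D-suc≥ k) (neg-antimono-≤ (e-suc≤½^ k)) ⟩
        D (suc k) - e q (suc k)              ≤⟨ D-step (suc k) ⟩
        D (suc (suc k))                      ∎
      where open ≤-Reasoning

    D≥¼ : ∀ J → ¼ ≤ D J
    D≥¼ zero = toWitness {a? = ¼ ≤? 1ℚ} _
    D≥¼ (suc k) = ≤-trans (subst (_≤ ¼ + ½^ (2 ℕ.+ k)) (+-identityʳ ¼) (+-monoʳ-≤ ¼ (½^-nonneg (2 ℕ.+ k))))
                          (D-suc≥ k)

    D*recipD : ∀ J → D J * recip (D J) ≡ 1ℚ
    D*recipD J = proj₁ (recip-¼ (D J) (D≥¼ J))

    recipD-nonneg : ∀ J → 0ℚ ≤ recip (D J)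
    recipD-nonneg J = proj₁ (proj₂ (recip-¼ (D J) (D≥¼ J)))

    recipD≤4 : ∀ J → recip (D J) ≤ four
    recipD≤4 J = proj₂ (proj₂ (recip-¼ (D J) (D≥¼ J)))

  ⌊n/2⌋-suc : ∀ M → ⌊ suc M /2⌋ ≡ ⌊ M /2⌋ ⊎ (⌊ suc M /2⌋ ≡ suc ⌊ M /2⌋ × suc M ≡ suc ⌊ M /2⌋ ℕ.+ suc ⌊ M /2⌋)
  ⌊n/2⌋-suc zero = inj₁ refl
  ⌊n/2⌋-suc (suc zero) = inj₂ (refl , refl)
  ⌊n/2⌋-suc (suc (suc M)) with ⌊n/2⌋-suc M
  ... | inj₁ eq = inj₁ (cong suc eq)
  ... | inj₂ (eq , even) = inj₂ (cong suc eq ,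
          cong (λ n → suc (suc n)) (trans even (sym (ℕ.+-suc ⌊ M /2⌋ (suc ⌊ M /2⌋)))))

  G : (ℕ → ℚ) → ℕ → ℚ → ℚ
  G a zero y = 0ℚ
  G a (suc M) y = G a M y + a (suc M) * y ^ℕ suc M

  G-nonneg : ∀ a → (∀ n → 0ℚ ≤ a n) → ∀ M {y} → 0ℚ ≤ y → 0ℚ ≤ G a M y
  G-nonneg a a≥0 zero 0≤y = ≤-refl
  G-nonneg a a≥0 (suc M) {y} 0≤y = subst (_≤ G a (suc M) y) (+-identityʳ 0ℚ)
    (+-mono-≤ (G-nonneg a a≥0 M 0≤y) (*-nonneg (a≥0 (suc M)) (^-nonneg (suc M) 0≤y)))

  -- For coefficients ≤ 1 and 0 ≤ y ≤ ½:  G_M(y) ≤ y + y² + … ≤ 2y.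
  G≤2y : ∀ a → (∀ n → a n ≤ 1ℚ) → ∀ M {y} → 0ℚ ≤ y → y ≤ ½ → G a M y ≤ two * y
  G≤2y a a≤1 M {y} 0≤y y≤½ = ≤-trans (subst (_≤ G a M y + two * y ^ℕ suc M) (+-identityʳ (G a M y))
                                         (+-monoʳ-≤ (G a M y) (*-nonneg 0≤two (^-nonneg (suc M) 0≤y))))
                                       (bound M)
    where
    bound : ∀ M → G a M y + two * y ^ℕ suc M ≤ two * y
    bound zero = ≤-reflexive (solve 1 (λ y → con 0ℚ :+ con two :* (y :* con 1ℚ) := con two :* y) refl y)
    bound (suc M) = begin
        G a M y + a (suc M) * Y + two * (y * Y)
          ≡⟨ solve 5 (λ g a y Y t → g :+ a :* Y :+ t :* (y :* Y) := g :+ (a :* Y :+ (t :* y) :* Y))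
                  refl (G a M y) (a (suc M)) y Y two ⟩
        G a M y + (a (suc M) * Y + (two * y) * Y)
          ≤⟨ +-monoʳ-≤ (G a M y) (+-mono-≤ (*-monoʳ-≤′ 0≤Y (a≤1 (suc M)))
                                      (*-monoʳ-≤′ 0≤Y 2y≤1)) ⟩
        G a M y + (1ℚ * Y + 1ℚ * Y)
          ≡⟨ solve 2 (λ g Y → g :+ (con 1ℚ :* Y :+ con 1ℚ :* Y) := g :+ con two :* Y) refl (G a M y) Y ⟩
        G a M y + two * Y
          ≤⟨ bound M ⟩
        two * y ∎
      where
      open ≤-Reasoning
      Y = y ^ℕ suc M
      0≤Y = ^-nonneg (suc M) 0≤y
      2y≤1 : two * y ≤ 1ℚ
      2y≤1 = *-monoˡ-≤-nonNeg two y≤½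

  functional-equation : ∀ a x → (∀ n → a n ≡ 1ℚ - G a ⌊ n /2⌋ x) →
    ∀ M y → (1ℚ - y) * G a M y + G a ⌊ M /2⌋ (x * (y * y)) ≡ y - a M * y ^ℕ suc M
  functional-equation a x a-rec zero y =
    trans (solve 1 (λ y → (con 1ℚ :- y) :* con 0ℚ :+ con 0ℚ := y :- (con 1ℚ :- con 0ℚ) :* (y :* con 1ℚ)) refl y)
          (cong (λ c → y - c * (y * 1ℚ)) (sym (a-rec 0)))
  functional-equation a x a-rec (suc M) y with ⌊n/2⌋-suc M
  ... | inj₁ eq = begin
      (1ℚ - y) * (G a M y + a (suc M) * Y) + G a ⌊ suc M /2⌋ z
        ≡⟨ cong₂ (λ c h → (1ℚ - y) * (G a M y + c * Y) + G a h z) a-same eq ⟩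
      (1ℚ - y) * (G a M y + a M * Y) + G a ⌊ M /2⌋ z
        ≡⟨ solve 5 (λ y g gh am Y → (con 1ℚ :- y) :* (g :+ am :* Y) :+ gh
                                      := ((con 1ℚ :- y) :* g :+ gh) :+ (con 1ℚ :- y) :* am :* Y)
                 refl y (G a M y) (G a ⌊ M /2⌋ z) (a M) Y ⟩
      ((1ℚ - y) * G a M y + G a ⌊ M /2⌋ z) + (1ℚ - y) * a M * Y
        ≡⟨ cong (_+ (1ℚ - y) * a M * Y) (functional-equation a x a-rec M y) ⟩
      (y - a M * Y) + (1ℚ - y) * a M * Y
        ≡⟨ solve 3 (λ y am Y → (y :- am :* Y) :+ (con 1ℚ :- y) :* am :* Y := y :- am :* (y :* Y)) refl y (a M) Y ⟩
      y - a M * (y * Y)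
        ≡⟨ cong (λ c → y - c * (y * Y)) (sym a-same) ⟩
      y - a (suc M) * (y * Y) ∎
    where
    open ≡-Reasoning
    Y = y ^ℕ suc M
    z = x * (y * y)
    a-same : a (suc M) ≡ a M
    a-same = trans (a-rec (suc M)) (trans (cong (λ h → 1ℚ - G a h x) eq) (sym (a-rec M)))
  ... | inj₂ (eq , even) = begin
      (1ℚ - y) * (G a M y + a (suc M) * Y) + G a ⌊ suc M /2⌋ z
        ≡⟨ cong₂ (λ c h → (1ℚ - y) * (G a M y + c * Y) + G a h z) a-drop eq ⟩
      (1ℚ - y) * (G a M y + (a M - c) * Y) + (G a h z + a (suc h) * z ^ℕ suc h)
        ≡⟨ cong (λ v → (1ℚ - y) * (G a M y + (a M - c) * Y) + (G a h z + a (suc h) * v)) zʰ⁺¹ ⟩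
      (1ℚ - y) * (G a M y + (a M - c) * Y) + (G a h z + a (suc h) * (x ^ℕ suc h * Y))
        ≡⟨ solve 7 (λ y g gh am ah xh Y → (con 1ℚ :- y) :* (g :+ (am :- ah :* xh) :* Y) :+ (gh :+ ah :* (xh :* Y))
                      := ((con 1ℚ :- y) :* g :+ gh) :+ ((con 1ℚ :- y) :* (am :- ah :* xh) :* Y :+ ah :* xh :* Y))
                 refl y (G a M y) (G a h z) (a M) (a (suc h)) (x ^ℕ suc h) Y ⟩
      ((1ℚ - y) * G a M y + G a h z) + ((1ℚ - y) * (a M - c) * Y + c * Y)
        ≡⟨ cong (_+ ((1ℚ - y) * (a M - c) * Y + c * Y)) (functional-equation a x a-rec M y) ⟩
      (y - a M * Y) + ((1ℚ - y) * (a M - c) * Y + c * Y)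
        ≡⟨ solve 4 (λ y am c Y → (y :- am :* Y) :+ ((con 1ℚ :- y) :* (am :- c) :* Y :+ c :* Y)
                                   := y :- (am :- c) :* (y :* Y))
                 refl y (a M) c Y ⟩
      y - (a M - c) * (y * Y)
        ≡⟨ cong (λ v → y - v * (y * Y)) (sym a-drop) ⟩
      y - a (suc M) * (y * Y) ∎
    where
    open ≡-Reasoning
    Y = y ^ℕ suc M
    z = x * (y * y)
    h = ⌊ M /2⌋
    c = a (suc h) * x ^ℕ suc h
    -- passing the even index M + 1 adds the term c to G_{⌊n/2⌋}(x)
    a-drop : a (suc M) ≡ a M - c
    a-drop = trans (a-rec (suc M)) (trans (cong (λ v → 1ℚ - G a v x) eq)
               (trans (solve 3 (λ g ah xh → con 1ℚ :- (g :+ ah :* xh) := (con 1ℚ :- g) :- ah :* xh)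
                                refl (G a h x) (a (suc h)) (x ^ℕ suc h))
                      (cong (_- c) (sym (a-rec M)))))
    zʰ⁺¹ : z ^ℕ suc h ≡ x ^ℕ suc h * Y
    zʰ⁺¹ = trans (^-* x (y * y) (suc h)) (cong (x ^ℕ suc h *_)
             (trans (^-* y y (suc h)) (trans (sym (^-+ y (suc h) (suc h))) (cong (y ^ℕ_) (sym even)))))

  halve : ℕ → ℕ → ℕ
  halve M zero = M
  halve M (suc J) = ⌊ halve M J /2⌋

  halve≥ : ∀ J M L → 2 ℕ.^ J ℕ.* L ℕ.≤ M → L ℕ.≤ halve M J
  halve≥ zero M L 2⁰L≤M = ℕ.≤-trans (ℕ.≤-reflexive (sym (ℕ.+-identityʳ L))) 2⁰L≤M
  halve≥ (suc J) M L 2ᴶ⁺¹L≤M = ℕ.≤-trans (ℕ.≤-reflexive (ℕ.n≡⌊n+n/2⌋ L))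
    (ℕ.⌊n/2⌋-mono (halve≥ J M (L ℕ.+ L) (ℕ.≤-trans (ℕ.≤-reflexive regroup) 2ᴶ⁺¹L≤M)))
    where
    regroup : 2 ℕ.^ J ℕ.* (L ℕ.+ L) ≡ 2 ℕ.^ suc J ℕ.* L
    regroup = trans (ℕ.*-distribˡ-+ (2 ℕ.^ J) L L)
                    (sym (trans (ℕ.*-assoc 2 (2 ℕ.^ J) L) (cong (2 ℕ.^ J ℕ.* L ℕ.+_) (ℕ.+-identityʳ _))))


  16*½^[4+t] : ∀ t → fromℕ 16 * ½^ (4 ℕ.+ t) ≡ ½^ t
  16*½^[4+t] t = solve 1 (λ h → con (fromℕ 16) :* (con ½ :* (con ½ :* (con ½ :* (con ½ :* h)))) := h) refl (½^ t)

  sign : ℕ → ℚ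
  sign J = (- 1ℚ) ^ℕ J

  ∣sign*p*r∣ : ∀ J {p r} → 0ℚ ≤ p → 0ℚ ≤ r → ∣ sign J * p * r ∣ ≡ p * r
  ∣sign*p*r∣ J {p} {r} 0≤p 0≤r = begin
      ∣ sign J * p * r ∣           ≡⟨ ∣p*q∣≡∣p∣*∣q∣ (sign J * p) r ⟩
      ∣ sign J * p ∣ * ∣ r ∣       ≡⟨ cong (_* ∣ r ∣) (∣p*q∣≡∣p∣*∣q∣ (sign J) p) ⟩
      ∣ sign J ∣ * ∣ p ∣ * ∣ r ∣   ≡⟨ cong₂ (λ s t → s * t * ∣ r ∣) (∣sign∣ J) (0≤p⇒∣p∣≡p 0≤p) ⟩
      1ℚ * p * ∣ r ∣               ≡⟨ cong₂ _*_ (*-identityˡ p) (0≤p⇒∣p∣≡p 0≤r) ⟩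
      p * r                        ∎
    where
    open ≡-Reasoning
    ∣sign∣ : ∀ J → ∣ sign J ∣ ≡ 1ℚ
    ∣sign∣ zero = refl
    ∣sign∣ (suc J) = trans (∣p*q∣≡∣p∣*∣q∣ (- 1ℚ) (sign J)) (cong (∣ - 1ℚ ∣ *_) (∣sign∣ J))

  -- Iterating the functional equation J times along y = e_0, e_1, …
  -- (e_{k+1} = x e_k²) turns G_M(x) into the J-th partial sum of the series,
  -- plus a remainder G_{m_J}(e_J)/D_J (m_J = M halved J times) and an
  -- accumulated truncation error; both are small once J and m_J are large.

  module Iteration (q : ℕ) (q≥2 : 2 ℕ.≤ q) (a : ℕ → ℚ)
                   (a≥0 : ∀ n → 0ℚ ≤ a n) (a≤1 : ∀ n → a n ≤ 1ℚ)
                   (a-rec : ∀ n → a n ≡ 1ℚ - G a ⌊ n /2⌋ (Exponents.x q q≥2)) where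

    open Exponents q q≥2

    -- the term a_m e^(m+1) dropped by the functional equation at step J
    dropped : ℕ → ℕ → ℚ
    dropped M J = a (halve M J) * e q J ^ℕ suc (halve M J)

    error : ℕ → ℕ → ℚ
    error M zero = 0ℚ
    error M (suc J) = error M J + sign J * dropped M J * recip (D (suc J))

    remainder : ℕ → ℕ → ℚ
    remainder M J = sign J * G a (halve M J) (e q J) * recip (D J)

    iterate : ∀ M J → G a M x ≡ partial q J + remainder M J - error M J
    iterate M zero = trans (cong (G a M) (sym e-zero))
      (solve 1 (λ g → g := con 0ℚ :+ con 1ℚ :* g :* con 1ℚ :- con 0ℚ) refl (G a M (e q 0)))
    iterate M (suc J) = begin
        G a M x
          ≡⟨ iterate M J ⟩
        P + s * H * r - E
          ≡⟨ cong (λ v → P + v - E) (sym (*-identityʳ (s * H * r))) ⟩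
        P + s * H * r * 1ℚ - E
          ≡⟨ cong (λ v → P + s * H * r * v - E) (sym (trans (cong (_* r′) (sym (D-suc J))) (D*recipD (suc J)))) ⟩
        P + s * H * r * (D J * (1ℚ - ε) * r′) - E
          ≡⟨ solve 9 (λ P s H r d ε r′ E one → P :+ s :* H :* r :* (d :* (one :- ε) :* r′) :- E
                        := P :+ s :* ((one :- ε) :* H) :* r′ :* (d :* r) :- E) refl P s H r (D J) ε r′ E 1ℚ ⟩
        P + s * ((1ℚ - ε) * H) * r′ * (D J * r) - E
          ≡⟨ cong₂ (λ u v → P + s * u * r′ * v - E) step (D*recipD J) ⟩
        P + s * (ε - A - H′) * r′ * 1ℚ - E
          ≡⟨ solve 7 (λ P s ε A H′ r′ E → P :+ s :* (ε :- A :- H′) :* r′ :* con 1ℚ :- E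
                        := P :+ s :* ε :* r′ :+ (con (- 1ℚ) :* s) :* H′ :* r′ :- (E :+ s :* A :* r′))
                   refl P s ε A H′ r′ E ⟩
        P + s * ε * r′ + (- 1ℚ) * s * H′ * r′ - (E + s * A * r′) ∎
      where
      open ≡-Reasoning
      P = partial q J
      s = sign J
      m = halve M J
      ε = e q J
      H = G a m ε
      H′ = G a (halve M (suc J)) (e q (suc J))
      A = dropped M J
      r = recip (D J)
      r′ = recip (D (suc J))
      E = error M J
      -- one application of the functional equation at y = e_J
      step : (1ℚ - ε) * H ≡ ε - A - H′
      step = trans (solve 2 (λ X H′ → X := (X :+ H′) :- H′) refl ((1ℚ - ε) * H) H′)
                   (cong (_- H′) (trans (cong (λ z → (1ℚ - ε) * H + G a ⌊ m /2⌋ z) (e-suc J))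
                                        (functional-equation a x a-rec m ε)))

    -- |remainder| ≤ 2 e_J · 4 ≤ 8 · ½^(J+1)
    ∣remainder∣≤ : ∀ M J → ∣ remainder M J ∣ ≤ two * ½^ (suc J) * four
    ∣remainder∣≤ M J = begin
        ∣ remainder M J ∣                   ≡⟨ ∣sign*p*r∣ J 0≤H (recipD-nonneg J) ⟩
        G a (halve M J) (e q J) * recip (D J) ≤⟨ *-mono-nonneg 0≤H (recipD-nonneg J)
                                                   (≤-trans (G≤2y a a≤1 (halve M J) (e-nonneg J) (e≤½ J))
                                                            (*-monoˡ-≤-nonNeg two (e≤½^ J)))
                                                   (recipD≤4 J) ⟩
        two * ½^ (suc J) * four          ∎
      where
      open ≤-Reasoning
      0≤H = G-nonneg a a≥0 (halve M J) (e-nonneg J)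

    -- each dropped term is at most ½^(m+1), so |error| ≤ 4J · ½^(m_J + 1)
    ∣error∣≤ : ∀ M J → ∣ error M J ∣ ≤ fromℕ J * four * ½^ (suc (halve M J))
    ∣error∣≤ M zero = ≤-reflexive (sym (trans (cong (_* ½^ (suc M)) (*-zeroˡ four)) (*-zeroˡ (½^ (suc M)))))
    ∣error∣≤ M (suc J) = begin
        ∣ error M J + sign J * A * r′ ∣
          ≤⟨ ∣p+q∣≤∣p∣+∣q∣ (error M J) (sign J * A * r′) ⟩
        ∣ error M J ∣ + ∣ sign J * A * r′ ∣
          ≡⟨ cong (_+_ ∣ error M J ∣) (∣sign*p*r∣ J 0≤A (recipD-nonneg (suc J))) ⟩
        ∣ error M J ∣ + A * r′
          ≤⟨ +-mono-≤ (∣error∣≤ M J) (*-mono-nonneg 0≤A (recipD-nonneg (suc J)) A≤ (recipD≤4 (suc J))) ⟩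
        fromℕ J * four * ½^ (suc m) + ½^ (suc m) * four
          ≤⟨ +-mono-≤ (*-monoˡ-≤′ (*-nonneg (fromℕ-nonneg J) 0≤four) halving)
                      (*-monoʳ-≤′ 0≤four halving) ⟩
        fromℕ J * four * ½^ (suc m′) + ½^ (suc m′) * four
          ≡⟨ solve 3 (λ j f h → j :* f :* h :+ h :* f := (con 1ℚ :+ j) :* f :* h) refl (fromℕ J) four (½^ (suc m′)) ⟩
        (1ℚ + fromℕ J) * four * ½^ (suc m′)
          ≡⟨ cong (λ v → v * four * ½^ (suc m′)) (sym (fromℕ-+ 1 J)) ⟩
        fromℕ (suc J) * four * ½^ (suc m′) ∎
      where
      open ≤-Reasoning
      m = halve M J
      m′ = ⌊ m /2⌋
      A = dropped M J
      r′ = recip (D (suc J))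
      0≤A : 0ℚ ≤ A
      0≤A = *-nonneg (a≥0 m) (^-nonneg (suc m) (e-nonneg J))
      A≤ : A ≤ ½^ (suc m)
      A≤ = ≤-trans (*-mono-nonneg (a≥0 m) (^-nonneg (suc m) (e-nonneg J)) (a≤1 m)
                                  (^-mono (suc m) (e-nonneg J) (e≤½ J)))
                   (≤-reflexive (*-identityˡ _))
      halving : ½^ (suc m) ≤ ½^ (suc m′)
      halving = ½^-anti (s≤s (ℕ.⌊n/2⌋≤n m))

    approximation : ∀ M J →
      ∣ G a M x - partial q J ∣ ≤ two * ½^ (suc J) * four + fromℕ J * four * ½^ (suc (halve M J))
    approximation M J = begin
        ∣ G a M x - partial q J ∣
          ≡⟨ cong (λ v → ∣ v - partial q J ∣) (iterate M J) ⟩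
        ∣ partial q J + remainder M J - error M J - partial q J ∣
          ≡⟨ cong ∣_∣ (solve 3 (λ P R E → P :+ R :- E :- P := R :- E)
                             refl (partial q J) (remainder M J) (error M J)) ⟩
        ∣ remainder M J - error M J ∣
          ≤⟨ ∣p-q∣≤∣p∣+∣q∣ (remainder M J) (error M J) ⟩
        ∣ remainder M J ∣ + ∣ error M J ∣
          ≤⟨ +-mono-≤ (∣remainder∣≤ M J) (∣error∣≤ M J) ⟩
        two * ½^ (suc J) * four + fromℕ J * four * ½^ (suc (halve M J)) ∎
      where open ≤-Reasoning

    -- |term_j| = e_j / D_{j+1} ≤ 4 · ½^(j+1)
    ∣term∣≤ : ∀ j → ∣ term q j ∣ ≤ ½^ (suc j) * four
    ∣term∣≤ j = begin
        ∣ term q j ∣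
          ≡⟨ ∣sign*p*r∣ j (e-nonneg j) (recipD-nonneg (suc j)) ⟩
        e q j * recip (D (suc j))
          ≤⟨ *-mono-nonneg (e-nonneg j) (recipD-nonneg (suc j)) (e≤½^ j) (recipD≤4 (suc j)) ⟩
        ½^ (suc j) * four ∎
      where open ≤-Reasoning

    partial-cauchy : ∀ J t → ∣ partial q (J ℕ.+ t) - partial q J ∣ ≤ four * (½^ J - ½^ (J ℕ.+ t))
    partial-cauchy J zero rewrite ℕ.+-identityʳ J =
      ≤-reflexive (trans (cong ∣_∣ (+-inverseʳ (partial q J)))
                         (sym (trans (cong (four *_) (+-inverseʳ (½^ J))) (*-zeroʳ four))))
    partial-cauchy J (suc t) rewrite ℕ.+-suc J t = begin
        ∣ P + term q (J ℕ.+ t) - P₀ ∣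
          ≡⟨ cong ∣_∣ (solve 3 (λ P T P₀ → P :+ T :- P₀ := (P :- P₀) :+ T) refl P (term q (J ℕ.+ t)) P₀) ⟩
        ∣ (P - P₀) + term q (J ℕ.+ t) ∣
          ≤⟨ ∣p+q∣≤∣p∣+∣q∣ (P - P₀) (term q (J ℕ.+ t)) ⟩
        ∣ P - P₀ ∣ + ∣ term q (J ℕ.+ t) ∣
          ≤⟨ +-mono-≤ (partial-cauchy J t) (∣term∣≤ (J ℕ.+ t)) ⟩
        four * (½^ J - ½^ (J ℕ.+ t)) + ½ * ½^ (J ℕ.+ t) * four
          ≡⟨ solve 3 (λ f a b → f :* (a :- b) :+ con ½ :* b :* f := f :* (a :- con ½ :* b))
                     refl four (½^ J) (½^ (J ℕ.+ t)) ⟩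
        four * (½^ J - ½ * ½^ (J ℕ.+ t)) ∎
      where
      open ≤-Reasoning
      P = partial q (J ℕ.+ t)
      P₀ = partial q J

    G≈partial : ∀ M J t → J ℕ.+ J ℕ.≤ halve M J → ∣ G a M x - partial q (J ℕ.+ t) ∣ ≤ fromℕ 16 * ½^ J
    G≈partial M J t 2J≤m = begin
        ∣ G a M x - Pₜ ∣
          ≡⟨ cong ∣_∣ (solve 3 (λ g pt p → g :- pt := (g :- p) :- (pt :- p)) refl (G a M x) Pₜ P) ⟩
        ∣ (G a M x - P) - (Pₜ - P) ∣
          ≤⟨ ∣p-q∣≤∣p∣+∣q∣ (G a M x - P) (Pₜ - P) ⟩
        ∣ G a M x - P ∣ + ∣ Pₜ - P ∣
          ≤⟨ +-mono-≤ (approximation M J) (partial-cauchy J t) ⟩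
        two * ½^ (suc J) * four + fromℕ J * four * ½^ (suc m) + four * (h - ½^ (J ℕ.+ t))
          ≤⟨ +-mono-≤ (+-monoʳ-≤ (two * ½^ (suc J) * four) error-small) drop-negative ⟩
        two * ½^ (suc J) * four + four * ½^ (suc J) + four * h
          ≡⟨ solve 1 (λ h → con two :* (con ½ :* h) :* con four :+ con four :* (con ½ :* h) :+ con four :* h
                        := con (fromℕ 10) :* h) refl h ⟩
        fromℕ 10 * h
          ≤⟨ *-monoʳ-≤′ (½^-nonneg J) (toWitness {a? = fromℕ 10 ≤? fromℕ 16} _) ⟩
        fromℕ 16 * h ∎
      where
      open ≤-Reasoning
      P = partial q J
      Pₜ = partial q (J ℕ.+ t)
      h = ½^ J
      m = halve M J
      -- 4J · ½^(m+1) ≤ 4J · ½^(2J+1) = 4 · ½^(J+1) · (J · ½^J) ≤ 4 · ½^(J+1)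
      error-small : fromℕ J * four * ½^ (suc m) ≤ four * ½^ (suc J)
      error-small = begin
          fromℕ J * four * ½^ (suc m)
            ≤⟨ *-monoˡ-≤′ (*-nonneg (fromℕ-nonneg J) 0≤four) (½^-anti (s≤s 2J≤m)) ⟩
          fromℕ J * four * ½^ (suc J ℕ.+ J)
            ≡⟨ cong (fromℕ J * four *_) (^-+ ½ (suc J) J) ⟩
          fromℕ J * four * (½^ (suc J) * h)
            ≡⟨ solve 4 (λ j f b h → j :* f :* (b :* h) := f :* b :* (j :* h)) refl (fromℕ J) four (½^ (suc J)) h ⟩
          four * ½^ (suc J) * (fromℕ J * h)
            ≤⟨ *-monoˡ-≤′ (*-nonneg 0≤four (½^-nonneg (suc J))) (n*½^n≤1 J) ⟩
          four * ½^ (suc J) * 1ℚ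
            ≡⟨ *-identityʳ _ ⟩
          four * ½^ (suc J) ∎
      drop-negative : four * (h - ½^ (J ℕ.+ t)) ≤ four * h
      drop-negative = *-monoˡ-≤′ 0≤four
        (≤-trans (+-monoʳ-≤ h (neg-antimono-≤ (½^-nonneg (J ℕ.+ t)))) (≤-reflexive (+-identityʳ h)))

-- The combinatorial and the analytic halves meet in the sequence
-- a_b = u_b / q^b, the proportion of unbordered words of length b.

module Instantiation (q : ℕ) (q≥2 : 2 ℕ.≤ q) where

  open import Data.Nat as ℕ using (ℕ; zero; suc; ⌊_/2⌋)
  import Data.Nat.Properties as ℕ
  open import Data.Rational using (ℚ; 0ℚ; 1ℚ; _+_; _*_; _-_; _≤_)
  open import Data.Rational.Properties
  open import Data.Rational.Solver using (module +-*-Solver)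
  open import Function using (_∘_)
  open import Relation.Binary.PropositionalEquality
  open +-*-Solver
  open Combinatorics
  open Analysis

  open Counting q
  open Exponents q q≥2

  a : ℕ → ℚ
  a b = fromℕ (u b) * x ^ℕ b

  C/qⁿ : ∀ n K → K ℕ.+ K ℕ.≤ n → fromℕ (C n K) * x ^ℕ n ≡ G a K x
  C/qⁿ n zero _ = *-zeroˡ (x ^ℕ n)
  C/qⁿ n (suc K) 2K+2≤n = begin
      fromℕ (C n K ℕ.+ u b ℕ.* q ℕ.^ r) * x ^ℕ n
        ≡⟨ cong (_* x ^ℕ n) (trans (fromℕ-+ (C n K) _)
                              (cong (fromℕ (C n K) +_) (trans (fromℕ-* (u b) _) (cong (fromℕ (u b) *_) (fromℕ-^ q r))))) ⟩
      (fromℕ (C n K) + fromℕ (u b) * Q ^ℕ r) * x ^ℕ n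
        ≡⟨ *-distribʳ-+ (x ^ℕ n) (fromℕ (C n K)) (fromℕ (u b) * Q ^ℕ r) ⟩
      fromℕ (C n K) * x ^ℕ n + fromℕ (u b) * Q ^ℕ r * x ^ℕ n
        ≡⟨ cong₂ _+_ (C/qⁿ n K (ℕ.≤-trans (ℕ.+-mono-≤ (ℕ.n≤1+n K) (ℕ.n≤1+n K)) 2K+2≤n)) new-term ⟩
      G a K x + a b * x ^ℕ b ∎
    where
    open ≡-Reasoning
    b = suc K
    r = n ℕ.∸ (b ℕ.+ b)
    -- u_b q^r / qⁿ = (u_b / q^b) / q^b  since n = 2b + r
    new-term : fromℕ (u b) * Q ^ℕ r * x ^ℕ n ≡ a b * x ^ℕ b
    new-term = begin
        fromℕ (u b) * Q ^ℕ r * x ^ℕ n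
          ≡⟨ cong (fromℕ (u b) * Q ^ℕ r *_) (trans (cong (x ^ℕ_) (sym (ℕ.m+[n∸m]≡n 2K+2≤n)))
                                               (trans (^-+ x (b ℕ.+ b) r) (cong (_* x ^ℕ r) (^-+ x b b)))) ⟩
        fromℕ (u b) * Q ^ℕ r * (x ^ℕ b * x ^ℕ b * x ^ℕ r)
          ≡⟨ solve 4 (λ U Qr xb xr → U :* Qr :* (xb :* xb :* xr) := U :* xb :* xb :* (Qr :* xr))
                   refl (fromℕ (u b)) (Q ^ℕ r) (x ^ℕ b) (x ^ℕ r) ⟩
        a b * x ^ℕ b * (Q ^ℕ r * x ^ℕ r)
          ≡⟨ cong (a b * x ^ℕ b *_) (Qⁿxⁿ r) ⟩
        a b * x ^ℕ b * 1ℚ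
          ≡⟨ *-identityʳ _ ⟩
        a b * x ^ℕ b ∎

  -- every word is unbordered or has a short border:  a_n + G_{⌊n/2⌋}(1/q) = 1
  a-rec : ∀ n → a n ≡ 1ℚ - G a ⌊ n /2⌋ x
  a-rec n = begin
      a n
        ≡⟨ solve 2 (λ a g → a := (a :+ g) :- g) refl (a n) (G a ⌊ n /2⌋ x) ⟩
      a n + G a ⌊ n /2⌋ x - G a ⌊ n /2⌋ x
        ≡⟨ cong (_- G a ⌊ n /2⌋ x) (sym total) ⟩
      1ℚ - G a ⌊ n /2⌋ x ∎
    where
    open ≡-Reasoning
    total : 1ℚ ≡ a n + G a ⌊ n /2⌋ x
    total = begin
      1ℚ
        ≡⟨ sym (trans (cong (_* x ^ℕ n) (fromℕ-^ q n)) (Qⁿxⁿ n)) ⟩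
      fromℕ (q ℕ.^ n) * x ^ℕ n
        ≡⟨ cong (λ m → fromℕ m * x ^ℕ n) (all-words n) ⟩
      fromℕ (u n ℕ.+ C n ⌊ n /2⌋) * x ^ℕ n
        ≡⟨ cong (_* x ^ℕ n) (fromℕ-+ (u n) _) ⟩
      (fromℕ (u n) + fromℕ (C n ⌊ n /2⌋)) * x ^ℕ n
        ≡⟨ *-distribʳ-+ (x ^ℕ n) (fromℕ (u n)) _ ⟩
      a n + fromℕ (C n ⌊ n /2⌋) * x ^ℕ n
        ≡⟨ cong (a n +_) (C/qⁿ n ⌊ n /2⌋ (⌊n/2⌋+⌊n/2⌋≤n n)) ⟩
      a n + G a ⌊ n /2⌋ x ∎

  -- 0 ≤ a_n ≤ 1, the upper bound again because G ≥ 0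
  a≥0 : ∀ n → 0ℚ ≤ a n
  a≥0 n = *-nonneg (fromℕ-nonneg (u n)) (^-nonneg n x-nonneg)

  a≤1 : ∀ n → a n ≤ 1ℚ
  a≤1 n = subst (_≤ 1ℚ) (sym (a-rec n))
    (≤-trans (+-monoʳ-≤ 1ℚ (neg-antimono-≤ (G-nonneg a a≥0 ⌊ n /2⌋ x-nonneg))) (≤-reflexive (+-identityʳ 1ℚ)))

  prob≡G : ∀ n c → NumInstances q n c → prob q n c ≡ G a ⌊ (n ℕ.∸ 1) /2⌋ x
  prob≡G n c ni = begin
      fromℕ c * recip (Q ^ℕ n)
        ≡⟨ cong₂ _*_ (cong fromℕ (trans (numInstances≡count n c ni) (count-instances n)))
                  (recip-unique (Q ^ℕ n) (x ^ℕ n) (Qⁿxⁿ n)) ⟩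
      fromℕ (C n ⌊ (n ℕ.∸ 1) /2⌋) * x ^ℕ n
        ≡⟨ C/qⁿ n ⌊ (n ℕ.∸ 1) /2⌋ (ℕ.≤-trans (⌊n/2⌋+⌊n/2⌋≤n (n ℕ.∸ 1)) (ℕ.m∸n≤m n 1)) ⟩
      G a ⌊ (n ℕ.∸ 1) /2⌋ x ∎
    where open ≡-Reasoning

  open Iteration q q≥2 a a≥0 a≤1 a-rec

  prob≈partial : ∀ j n m c → suc (2 ℕ.^ j ℕ.* (j ℕ.+ j) ℕ.+ 2 ℕ.^ j ℕ.* (j ℕ.+ j)) ℕ.≤ n → j ℕ.≤ m →
                 NumInstances q n c → ∣ prob q n c - partial q m ∣ ≤ fromℕ 16 * ½^ j
  prob≈partial j n m c n-large m≥j ni = begin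
      ∣ prob q n c - partial q m ∣
        ≡⟨ cong₂ (λ p m → ∣ p - partial q m ∣) (prob≡G n c ni) (sym (ℕ.m+[n∸m]≡n m≥j)) ⟩
      ∣ G a K x - partial q (j ℕ.+ (m ℕ.∸ j)) ∣
        ≤⟨ G≈partial K j (m ℕ.∸ j) (halve≥ j K (j ℕ.+ j) L≤K) ⟩
      fromℕ 16 * ½^ j ∎
    where
    open ≤-Reasoning
    L = 2 ℕ.^ j ℕ.* (j ℕ.+ j)
    K = ⌊ (n ℕ.∸ 1) /2⌋
    L≤K : L ℕ.≤ K
    L≤K = ℕ.≤-trans (ℕ.≤-reflexive (ℕ.n≡⌊n+n/2⌋ L)) (ℕ.⌊n/2⌋-mono (ℕ.∸-monoˡ-≤ 1 n-large))

theorem3p4 : (q : ℕ) → q ≥ 2 →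
    (ε : ℚ) → 0ℚ < ε →
      ∃[ N ] ∃[ M ] ((n m c : ℕ) → n ≥ N → m ≥ M → NumInstances q n c →
        ∣ prob q n c - partial q m ∣ < ε)
-- Choose t with ½ᵗ < ε, then j = 4 + t (so that 16 · ½^j = ½ᵗ) and N past
-- the threshold of prob≈partial.
theorem3p4 q q≥2 ε ε>0 with Analysis.½^-small ε ε>0
... | t , ½ᵗ<ε = ℕ.suc (L ℕ.+ L) , j , λ n m c n-large m≥j ni →
      ℚ.≤-<-trans (ℚ.≤-trans (prob≈partial j n m c n-large m≥j ni) (ℚ.≤-reflexive (16*½^[4+t] t))) ½ᵗ<ε
  where
  open Analysis using (16*½^[4+t])
  open Instantiation q q≥2 using (prob≈partial)
  j = 4 ℕ.+ t
  L = 2 ℕ.^ j ℕ.* (j ℕ.+ j)
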